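{- Let $G$ be a finite connected graph with at least one edge, $\Delta$ a decision tree for $G$, $T$ a spanning tree of $G$, and $I_T$ the set of subgraphs of $G$ having the same history as $T$. Then $$\sum_{S\in I_T}(x-1)^{c(S)-1}(y-1)^{\beta(S)}=x^{|\mathcal I(T)|}y^{|\mathcal E(T)|},$$ where $\mathcal I(T)$ (resp. $\mathcal E(T)$) is the set of $\Delta$-active edges of $T$ lying in $T$ (resp. not in $T$).
   Context: Graphs are finite, loops and multiple edges allowed; $m=|E(G)|$. Subgraphs are spanning, identified with edge sets; $c(S)$ is the number of connected components of the spanning subgraph $S$ and $\beta(S)=c(S)+|S|-|V(G)|$. An isthmus is an edge whose deletion increases the number of connected components; an edge is standard if neither a loop nor an isthmus. A decision tree for $G$ is a perfect binary tree with all leaves at depth $m-1$ (root at depth $0$), each node labelled by an edge, such that along every root-to-leaf path the labels form a permutation of $E(G)$. Given a subgraph $S$: set $H:=G$, $n:=$ root of $\Delta$; for $k=1,\dots,m$ let $e_k$ be the label of $n$ and do exactly one of: (i) if $e_k$ is standard in $H$ and $e_k\notin S$: type $\mathbf S_e$, $H:=H\setminus e_k$ (deletion), $n:=$ left child; (ii) if $e_k$ is a loop of $H$: type $\mathbf L$, $H:=H\setminus e_k$, $n:=$ left child; (iii) if $e_k$ is standard in $H$ and $e_k\in S$: type $\mathbf S_i$, $H:=H/e_k$ (contraction), $n:=$ right child; (iv) if $e_k$ is an isthmus of $H$: type $\mathbf I$, $H:=H/e_k$, $n:=$ right child. An edge is $\Delta$-active for $S$ if its type is $\mathbf L$ or $\mathbf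 I$. The history of $S$ is the sequence $(e_1,t_1),\dots,(e_m,t_m)$, $t_k$ the type of $e_k$. -}

module Defs where

open import Data.Bool using (Bool; true; false; _∧_; _∨_; not; if_then_else_; T)
open import Data.Nat using (ℕ; zero; suc; _+_; _∸_; _<ᵇ_)
open import Data.Fin using (Fin; toℕ)
open import Data.Fin.Properties using (_≟_)
open import Data.Product using (_×_; _,_; proj₁; proj₂)
open import Data.List using (List; []; _∷_; _++_; map; allFin; length; filter)
open import Data.Bool.ListAction using (any)
open import Data.List.Relation.Unary.All using (All)
open import Data.List.Relation.Binary.Permutation.Propositional using (_↭_)
open import Data.Vec using (Vec; []; _∷_; lookup)
open import Data.Integer as ℤ using (ℤ)
open import Relation.Nullary using (Dec; yes; no; does)
open import Relation.Binary.PropositionalEquality using (_≡_; refl)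

-- A finite graph (loops and multiple edges allowed):
-- vertices Fin n, edges Fin m, each edge has two (possibly equal) endpoints.
record Graph : Set where
  field
    n    : ℕ
    m    : ℕ
    ends : Fin m → Fin n × Fin n
open Graph public

-- Subgraphs (spanning, identified with edge sets) = subsets of E(G).
Sub : ℕ → Set
Sub m = Vec Bool m

_∈ₛ_ : ∀ {m} → Fin m → Sub m → Bool
e ∈ₛ S = lookup S e

_==_ : ∀ {k} → Fin k → Fin k → Bool
a == b = does (a ≟ b)

anyFin : ∀ {k} → (Fin k → Bool) → Bool
anyFin {k} p = any p (allFin k)

countFin : ∀ {k} → (Fin k → Bool) → ℕ
countFin {k} p = length (filter (λ i → T? (p i)) (allFin k))
  where
  open import Relation.Nullary.Decidable using () renaming (T? to T?)

card : ∀ {m} → Sub m → ℕ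
card S = countFin (λ e → e ∈ₛ S)

allSubs : ∀ m → List (Sub m)
allSubs zero = [] ∷ []
allSubs (suc m) = map (true ∷_) (allSubs m) ++ map (false ∷_) (allSubs m)

-- A minor H of G obtained by deletions/contractions.  Its edges are the
-- edges of G that are still present; its vertices are the vertices of G
-- still alive (contracting an edge uv merges v into u: v dies and every
-- endpoint v is renamed u).
record Minor (n m : ℕ) : Set where
  field
    alive   : Fin n → Bool
    present : Fin m → Bool
    hends   : Fin m → Fin n × Fin n
open Minor public

subgraph : (G : Graph) → Sub (m G) → Minor (n G) (m G)
subgraph G S = record { alive = λ _ → true ; present = λ e → e ∈ₛ S ; hends = ends G }

whole : (G : Graph) → Minor (n G) (m G)
whole G = record { alive = λ _ → true ; present = λ _ → true ; hends = ends G }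

stepR : ∀ {n m} → Minor n m → (Fin n → Bool) → (Fin n → Bool)
stepR H R w = R w ∨ anyFin (λ f → present H f ∧
   ((R (proj₁ (hends H f)) ∧ (w == proj₂ (hends H f))) ∨
    (R (proj₂ (hends H f)) ∧ (w == proj₁ (hends H f)))))

iter : ∀ {A : Set} → ℕ → (A → A) → A → A
iter zero f a = a
iter (suc k) f a = f (iter k f a)

-- reach H u w : w is joined to u by a walk in H (walks of length ≤ n suffice)
reach : ∀ {n m} → Minor n m → Fin n → Fin n → Bool
reach {n} H u = iter n (stepR H) (λ w → u == w)

-- number of connected components of H: count the alive vertices that are
-- the smallest alive vertex of their component
comps : ∀ {n m} → Minor n m → ℕ
comps H = countFin (λ w → alive H w ∧
   not (anyFin (λ u → alive H u ∧ (toℕ u <ᵇ toℕ w) ∧ reach H w u)))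

c : (G : Graph) → Sub (m G) → ℕ
c G S = comps (subgraph G S)

β : (G : Graph) → Sub (m G) → ℕ
β G S = c G S + card S ∸ n G

Connected : Graph → Set
Connected G = comps (whole G) ≡ 1

delete : ∀ {n m} → Minor n m → Fin m → Minor n m
delete H e = record H { present = λ f → present H f ∧ not (f == e) }

contract : ∀ {n m} → Minor n m → Fin m → Minor n m
contract H e = record
  { alive   = λ w → alive H w ∧ not (w == v)
  ; present = λ f → present H f ∧ not (f == e)
  ; hends   = λ f → ren (proj₁ (hends H f)) , ren (proj₂ (hends H f)) }
  where
  u = proj₁ (hends H e)
  v = proj₂ (hends H e)
  ren : _ → _
  ren w = if w == v then u else w

isLoop : ∀ {n m} → Minor n m → Fin m → Bool
isLoop H e = present H e ∧ (proj₁ (hends H e) == proj₂ (hends H e))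

isIsthmus : ∀ {n m} → Minor n m → Fin m → Bool
isIsthmus H e = present H e ∧ (comps H <ᵇ comps (delete H e))

-- spanning tree: connected, and every edge of T is an isthmus of T (acyclic)
SpanningTree : (G : Graph) → Sub (m G) → Set
SpanningTree G T = c G T ≡ 1 ×
  ((e : Fin (m G)) → e ∈ₛ T ≡ true → isIsthmus (subgraph G T) e ≡ true)

data DTree (m : ℕ) : ℕ → Set where
  leaf : Fin m → DTree m zero
  node : ∀ {h} → Fin m → DTree m h → DTree m h → DTree m (suc h)

paths : ∀ {m h} → DTree m h → List (List (Fin m))
paths (leaf e) = (e ∷ []) ∷ []
paths (node e l r) = map (e ∷_) (paths l ++ paths r)

IsDecisionTree : (G : Graph) → DTree (m G) (m G ∸ 1) → Set
IsDecisionTree G Δ = All (λ p → p ↭ allFin (m G)) (paths Δ)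

data EType : Set where
  Se L Si I : EType

_≟T_ : (a b : EType) → Dec (a ≡ b)
Se ≟T Se = yes refl
L ≟T L = yes refl
Si ≟T Si = yes refl
I ≟T I = yes refl
Se ≟T L = no λ ()
Se ≟T Si = no λ ()
Se ≟T I = no λ ()
L ≟T Se = no λ ()
L ≟T Si = no λ ()
L ≟T I = no λ ()
Si ≟T Se = no λ ()
Si ≟T L = no λ ()
Si ≟T I = no λ ()
I ≟T Se = no λ ()
I ≟T L = no λ ()
I ≟T Si = no λ ()

-- type of edge e in H w.r.t. S, and the resulting minor and direction
-- (false = left child, true = right child)
classify : ∀ {n m} → Sub m → Minor n m → Fin m → EType
classify S H e with isLoop H e
... | true = L
... | false with isIsthmus H e
...   | true = I
...   | false = if e ∈ₛ S then Si else Se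

apply : ∀ {n m} → Minor n m → Fin m → EType → Minor n m
apply H e Se = delete H e
apply H e L  = delete H e
apply H e Si = contract H e
apply H e I  = contract H e

goesRight : EType → Bool
goesRight Se = false
goesRight L  = false
goesRight Si = true
goesRight I  = true

run : ∀ {n m h} → Sub m → Minor n m → DTree m h → List (Fin m × EType)
run S H (leaf e) = (e , classify S H e) ∷ []
run S H (node e l r) with classify S H e
... | t = (e , t) ∷ (if goesRight t then run S (apply H e t) r else run S (apply H e t) l)

history : (G : Graph) → DTree (m G) (m G ∸ 1) → Sub (m G) → List (Fin (m G) × EType)
history G Δ S = run S (whole G) Δ

_≟H_ : ∀ {m} → (a b : List (Fin m × EType)) → Dec (a ≡ b)
_≟H_ = ≡-dec (×-≡-dec _≟_ _≟T_)
  where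
  open import Data.List.Properties using (≡-dec)
  open import Data.Product.Properties using () renaming (≡-dec to ×-≡-dec)

isActive : EType → Bool
isActive L = true
isActive I = true
isActive _ = false

internalActive : (G : Graph) → DTree (m G) (m G ∸ 1) → Sub (m G) → ℕ
internalActive G Δ T = length (filter (λ p → T? (isActive (proj₂ p) ∧ (proj₁ p ∈ₛ T))) (history G Δ T))
  where open import Relation.Nullary.Decidable using () renaming (T? to T?)

externalActive : (G : Graph) → DTree (m G) (m G ∸ 1) → Sub (m G) → ℕ
externalActive G Δ T = length (filter (λ p → T? (isActive (proj₂ p) ∧ not (proj₁ p ∈ₛ T))) (history G Δ T))
  where open import Relation.Nullary.Decidable using () renaming (T? to T?)

I-T : (G : Graph) → DTree (m G) (m G ∸ 1) → Sub (m G) → List (Sub (m G))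
I-T G Δ T = filter (λ S → history G Δ S ≟H history G Δ T) (allSubs (m G))

_^ℤ_ : ℤ → ℕ → ℤ
x ^ℤ zero = ℤ.+ 1
x ^ℤ suc k = x ℤ.* (x ^ℤ k)

sumℤ : List ℤ → ℤ
sumℤ [] = ℤ.+ 0
sumℤ (a ∷ as) = a ℤ.+ sumℤ as

module Submission where

-- Run the decision tree on a subgraph S, keeping the current minor
-- H and the restriction of S to it.  Deleting an edge never changes the
-- number of components of S; contracting an edge of S, or an isthmus of H
-- lying outside S, removes one vertex and keeps, resp. lowers by one, that
-- number.  Adding this up along the run gives the run invariant
--   c(S) + #{Sᵢ, I in h} = n + #{I-edges of h outside S},
--   |S| = #{edges of h lying in S}.
-- A subgraph has history h iff it contains the Sᵢ-edges of h and avoids its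
-- Sₑ-edges.  Applied to T (and to T with one edge toggled) the invariant
-- forces every I-edge of h into T and every L-edge out of T.  Hence for S
-- in I_T:  c(S) - 1 = #{I-edges outside S} and β(S) = #{L-edges in S}, so
-- the summand is a product over the entries of h of a factor depending only
-- on the type of the edge and on its membership in S, and vanishes when S
-- is inconsistent with h.  As h lists every edge exactly once, summing over
-- all 2^m subsets factorises into per-edge sums: 1 for Sᵢ/Sₑ, x for I and y
-- for L edges, which is the right-hand side.

open import Defs
open import Data.Bool using (Bool; true; false; _∧_; _∨_; not; if_then_else_; T)
open import Data.Bool.ListAction using (any)
open import Data.Bool.Properties using (∧-identityʳ; ∧-zeroʳ; ∨-zeroʳ; ∨-identityʳ)
open import Data.Nat using (ℕ; zero; suc; _+_; _∸_; _<ᵇ_; _≤_; _<_; _≥_; z≤n; s≤s)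
import Data.Nat.Properties as ℕP
open import Data.Nat.Solver using (module +-*-Solver)
open import Algebra.Properties.CommutativeSemigroup ℕP.+-commutativeSemigroup using (interchange)
open import Data.Integer using (ℤ; _-_; +_)
import Data.Integer as ℤ
import Data.Integer.Properties as ℤP
import Data.Integer.Solver as ℤSolver
open import Data.Fin using (Fin; toℕ; zero; suc; fromℕ<)
open import Data.Fin.Properties using (_≟_; toℕ-injective)
open import Data.Product using (_×_; _,_; proj₁; proj₂; Σ; ∃)
open import Data.Sum using (_⊎_; inj₁; inj₂)
open import Data.Empty using (⊥; ⊥-elim)
open import Data.Unit using (tt)
open import Data.List using (List; []; _∷_; _++_; map; filter; length; allFin; tabulate)
open import Data.List.Relation.Unary.All using (All; []; _∷_)
import Data.List.Relation.Unary.All as All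
import Data.List.Relation.Unary.All.Properties as AllP
open import Data.List.Relation.Unary.Any using (here; there)
open import Data.List.Membership.Propositional using (_∈_)
open import Data.List.Membership.Propositional.Properties using (∈-map⁺; ∈-++⁺ˡ; ∈-++⁺ʳ)
open import Data.List.Relation.Binary.Permutation.Propositional as Perm using (_↭_)
open import Data.Vec using (_∷_; lookup; _[_]≔_)
open import Data.Vec.Properties using (lookup∘update; lookup∘update′)
open import Relation.Nullary using (Dec; yes; no; does)
open import Relation.Nullary.Decidable using (T?)
open import Relation.Binary using (Tri; tri<; tri≈; tri>)
open import Relation.Binary.PropositionalEquality
  using (_≡_; _≢_; refl; sym; trans; cong; cong₂; subst; subst₂; module ≡-Reasoning)
open import Function using (id)

∧-true : ∀ {a b} → a ∧ b ≡ true → a ≡ true × b ≡ true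
∧-true {true} {true} _ = refl , refl

∨-true : ∀ {a b} → a ∨ b ≡ true → a ≡ true ⊎ b ≡ true
∨-true {true} _ = inj₁ refl
∨-true {false} h = inj₂ h

∧-falseˡ : ∀ {a b} → a ≡ false → a ∧ b ≡ false
∧-falseˡ refl = refl

drop-middle : ∀ {a b c} → (a ∧ b) ∧ c ≡ true → a ∧ c ≡ true
drop-middle {true} {true} {true} _ = refl

∧-swapʳ : ∀ a b c → (a ∧ b) ∧ c ≡ (a ∧ c) ∧ b
∧-swapʳ true true c = sym (∧-identityʳ c)
∧-swapʳ true false c = sym (∧-zeroʳ c)
∧-swapʳ false b c = refl

not-true : ∀ {b} → not b ≡ true → b ≡ false
not-true {false} _ = refl

false≢true : false ≢ true
false≢true ()

bool-ext : ∀ {x y : Bool} → (x ≡ true → y ≡ true) → (y ≡ true → x ≡ true) → x ≡ y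
bool-ext {true} {true} _ _ = refl
bool-ext {false} {false} _ _ = refl
bool-ext {true} {false} f _ = sym (f refl)
bool-ext {false} {true} _ g = g refl

<ᵇ-true : ∀ {a b} → (a <ᵇ b) ≡ true → a < b
<ᵇ-true {a} {b} h = ℕP.<ᵇ⇒< a b (subst T (sym h) tt)

<ᵇ-intro : ∀ {a b} → a < b → (a <ᵇ b) ≡ true
<ᵇ-intro {a} {b} h with a <ᵇ b | ℕP.<⇒<ᵇ h
... | true | _ = refl

==-refl : ∀ {k} (a : Fin k) → (a == a) ≡ true
==-refl zero = refl
==-refl (suc a) = ==-refl a

==-true : ∀ {k} {a b : Fin k} → (a == b) ≡ true → a ≡ b
==-true {a = a} {b} h with a ≟ b
... | yes p = p
==-true {a = a} {b} () | no _

==-false : ∀ {k} {a b : Fin k} → (a == b) ≡ false → a ≢ b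
==-false {a = a} {b} h with a ≟ b
==-false {a = a} {b} () | yes _
... | no p = p

==-≢ : ∀ {k} {a b : Fin k} → a ≢ b → (a == b) ≡ false
==-≢ {a = a} {b} ne with a ≟ b
... | yes p = ⊥-elim (ne p)
... | no _ = refl

ind : Bool → ℕ
ind true = 1
ind false = 0

-- Number of i with p i, and whether some i has p i, by recursion on k;
-- these are the structural forms of countFin and anyFin of Defs.
count : ∀ {k} → (Fin k → Bool) → ℕ
count {zero} p = 0
count {suc k} p = ind (p zero) + count (λ i → p (suc i))

some : ∀ {k} → (Fin k → Bool) → Bool
some {zero} p = false
some {suc k} p = p zero ∨ some (λ i → p (suc i))

countFin≡count : ∀ {k} (p : Fin k → Bool) → countFin p ≡ count p
countFin≡count p = go p id
  where
  go : ∀ {k j} (p : Fin j → Bool) (g : Fin k → Fin j) →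
    length (filter (λ i → T? (p i)) (tabulate g)) ≡ count (λ i → p (g i))
  go {zero} p g = refl
  go {suc k} p g with p (g zero)
  ... | true = cong suc (go p (λ i → g (suc i)))
  ... | false = go p (λ i → g (suc i))

anyFin≡some : ∀ {k} (p : Fin k → Bool) → anyFin p ≡ some p
anyFin≡some p = go p id
  where
  go : ∀ {k j} (p : Fin j → Bool) (g : Fin k → Fin j) → any p (tabulate g) ≡ some (λ i → p (g i))
  go {zero} p g = refl
  go {suc k} p g = cong (p (g zero) ∨_) (go p (λ i → g (suc i)))

_≐_ : ∀ {k} {A : Set} → (Fin k → A) → (Fin k → A) → Set
p ≐ q = ∀ i → p i ≡ q i

_⊆ᵇ_ : ∀ {k} → (Fin k → Bool) → (Fin k → Bool) → Set
p ⊆ᵇ q = ∀ i → p i ≡ true → q i ≡ true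

count-cong : ∀ {k} {p q : Fin k → Bool} → p ≐ q → count p ≡ count q
count-cong {zero} e = refl
count-cong {suc k} e = cong₂ _+_ (cong ind (e zero)) (count-cong (λ i → e (suc i)))

some-cong : ∀ {k} {p q : Fin k → Bool} → p ≐ q → some p ≡ some q
some-cong {zero} e = refl
some-cong {suc k} e = cong₂ _∨_ (e zero) (some-cong (λ i → e (suc i)))

some-witness : ∀ {k} (p : Fin k → Bool) → some p ≡ true → ∃ λ i → p i ≡ true
some-witness {zero} p ()
some-witness {suc k} p h with p zero in eq
... | true = zero , eq
... | false with some-witness (λ i → p (suc i)) h
...   | i , q = suc i , q

some-intro : ∀ {k} (p : Fin k → Bool) i → p i ≡ true → some p ≡ true
some-intro {suc k} p zero h rewrite h = refl
some-intro {suc k} p (suc i) h =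
  trans (cong (p zero ∨_) (some-intro (λ j → p (suc j)) i h)) (∨-zeroʳ (p zero))

some-false : ∀ {k} (p : Fin k → Bool) → some p ≡ false → ∀ i → p i ≡ false
some-false p h i with p i in eq
... | false = refl
... | true = ⊥-elim (false≢true (trans (sym h) (some-intro p i eq)))

none⇒some-false : ∀ {k} (p : Fin k → Bool) → (∀ i → p i ≡ false) → some p ≡ false
none⇒some-false p h with some p in eq
... | false = refl
... | true with some-witness p eq
...   | i , q = ⊥-elim (false≢true (trans (sym (h i)) q))

count-≤ : ∀ {k} (p : Fin k → Bool) → count p ≤ k
count-≤ {zero} p = z≤n
count-≤ {suc k} p with p zero
... | true = s≤s (count-≤ (λ i → p (suc i)))
... | false = ℕP.m≤n⇒m≤1+n (count-≤ (λ i → p (suc i)))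

count-pos : ∀ {k} (p : Fin k → Bool) i → p i ≡ true → 1 ≤ count p
count-pos {suc k} p zero h rewrite h = s≤s z≤n
count-pos {suc k} p (suc i) h =
  ℕP.≤-trans (count-pos (λ j → p (suc j)) i h) (ℕP.m≤n+m _ (ind (p zero)))

count-all : ∀ k → count {k} (λ _ → true) ≡ k
count-all zero = refl
count-all (suc k) = cong suc (count-all k)

count-none : ∀ k → count {k} (λ _ → false) ≡ 0
count-none zero = refl
count-none (suc k) = count-none k

count-mono : ∀ {k} (p q : Fin k → Bool) → p ⊆ᵇ q → count p ≤ count q
count-mono {zero} p q h = z≤n
count-mono {suc k} p q h with p zero in e1 | q zero in e2
... | true | true = s≤s (count-mono _ _ (λ i → h (suc i)))
... | false | true = ℕP.m≤n⇒m≤1+n (count-mono _ _ (λ i → h (suc i)))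
... | false | false = count-mono _ _ (λ i → h (suc i))
... | true | false = ⊥-elim (false≢true (trans (sym e2) (h zero e1)))

count-strict : ∀ {k} (p q : Fin k → Bool) → p ⊆ᵇ q →
  ∀ i → p i ≡ false → q i ≡ true → count p < count q
count-strict {suc k} p q h zero e1 e2 rewrite e1 | e2 = s≤s (count-mono _ _ (λ i → h (suc i)))
count-strict {suc k} p q h (suc i) e1 e2 with p zero in f1 | q zero in f2
... | true | true = s≤s (count-strict _ _ (λ j → h (suc j)) i e1 e2)
... | false | true = ℕP.m≤n⇒m≤1+n (count-strict _ _ (λ j → h (suc j)) i e1 e2)
... | false | false = count-strict _ _ (λ j → h (suc j)) i e1 e2
... | true | false = ⊥-elim (false≢true (trans (sym f2) (h zero f1)))

count-update : ∀ {k} (p q : Fin k → Bool) (a : Fin k) → (∀ i → i ≢ a → p i ≡ q i) →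
  count p + ind (q a) ≡ count q + ind (p a)
count-update {suc k} p q zero h
  rewrite count-cong {p = λ i → p (suc i)} {q = λ i → q (suc i)} (λ i → h (suc i) (λ ()))
  = swap₃ (ind (p zero)) (count (λ i → q (suc i))) (ind (q zero))
  where
  open +-*-Solver using (solve; _:+_; _:=_)
  swap₃ : ∀ a c b → a + c + b ≡ b + c + a
  swap₃ = solve 3 (λ a c b → a :+ c :+ b := b :+ c :+ a) refl
count-update {suc k} p q (suc a) h rewrite h zero (λ ()) =
  trans (ℕP.+-assoc (ind (q zero)) _ _)
    (trans (cong (_+_ (ind (q zero)))
             (count-update (λ i → p (suc i)) (λ i → q (suc i)) a (λ i ne → h (suc i) (λ e → ne (suc-inj e)))))
       (sym (ℕP.+-assoc (ind (q zero)) _ _)))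
  where
  suc-inj : ∀ {j} {x y : Fin j} → Fin.suc x ≡ suc y → x ≡ y
  suc-inj refl = refl

end₁ end₂ : ∀ {n m} → Minor n m → Fin m → Fin n
end₁ H f = proj₁ (hends H f)
end₂ H f = proj₂ (hends H f)

data Adj {n m} (H : Minor n m) : Fin n → Fin n → Set where
  fwd : ∀ f → present H f ≡ true → Adj H (end₁ H f) (end₂ H f)
  bwd : ∀ f → present H f ≡ true → Adj H (end₂ H f) (end₁ H f)

data Conn {n m} (H : Minor n m) (a : Fin n) : Fin n → Set where
  base : Conn H a a
  step : ∀ {x y} → Conn H a x → Adj H x y → Conn H a y

adj-sym : ∀ {n m} {H : Minor n m} {x y} → Adj H x y → Adj H y x
adj-sym (fwd f p) = bwd f p
adj-sym (bwd f p) = fwd f p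

conn-trans : ∀ {n m} {H : Minor n m} {a b d} → Conn H a b → Conn H b d → Conn H a d
conn-trans p base = p
conn-trans p (step q x) = step (conn-trans p q) x

conn1 : ∀ {n m} {H : Minor n m} {x y} → Adj H x y → Conn H x y
conn1 = step base

conn-sym : ∀ {n m} {H : Minor n m} {a b} → Conn H a b → Conn H b a
conn-sym base = base
conn-sym (step p ad) = conn-trans (conn1 (adj-sym ad)) (conn-sym p)

conn-≡ : ∀ {n m} {H : Minor n m} {a b} → a ≡ b → Conn H a b
conn-≡ refl = base

conn-map : ∀ {n m} {K K' : Minor n m} (g : Fin n → Fin n) →
  (∀ {x y} → Adj K x y → Conn K' (g x) (g y)) → ∀ {a b} → Conn K a b → Conn K' (g a) (g b)
conn-map g h base = base
conn-map g h (step p ad) = conn-trans (conn-map g h p) (h ad)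

conn-lift : ∀ {n m} {K K' : Minor n m} → (∀ {x y} → Adj K x y → Conn K' x y) →
  ∀ {a b} → Conn K a b → Conn K' a b
conn-lift = conn-map id

-- Soundness is by
-- induction on the iterate; completeness because the growing sets are
-- nested subsets of an n-element set, so they are stable after n steps.
module Reachability {n m} (H : Minor n m) (a : Fin n) where

  R : ℕ → Fin n → Bool
  R k = iter k (stepR H) (λ w → a == w)

  edgeInto : (Fin n → Bool) → Fin n → Fin m → Bool
  edgeInto Q w f = present H f ∧ ((Q (end₁ H f) ∧ (w == end₂ H f)) ∨ (Q (end₂ H f) ∧ (w == end₁ H f)))

  stepR≡ : ∀ Q w → stepR H Q w ≡ (Q w ∨ some (edgeInto Q w))
  stepR≡ Q w = cong (Q w ∨_) (anyFin≡some (edgeInto Q w))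

  stepR-sound : ∀ Q → (∀ w → Q w ≡ true → Conn H a w) → ∀ w → stepR H Q w ≡ true → Conn H a w
  stepR-sound Q hq w h with ∨-true (trans (sym (stepR≡ Q w)) h)
  ... | inj₁ q = hq w q
  ... | inj₂ q with some-witness (edgeInto Q w) q
  ...   | f , e with ∧-true e
  ...     | pr , e' with ∨-true e'
  ...       | inj₁ z with ∧-true z
  ...         | q1 , w2 = subst (Conn H a) (sym (==-true w2)) (step (hq _ q1) (fwd f pr))
  stepR-sound Q hq w h | inj₂ q | f , e | pr , e' | inj₂ z with ∧-true z
  ...         | q1 , w2 = subst (Conn H a) (sym (==-true w2)) (step (hq _ q1) (bwd f pr))

  R-sound : ∀ k w → R k w ≡ true → Conn H a w
  R-sound zero w h = conn-≡ (==-true h)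
  R-sound (suc k) w h = stepR-sound (R k) (R-sound k) w h

  stepR-grows : ∀ Q w → Q w ≡ true → stepR H Q w ≡ true
  stepR-grows Q w h rewrite h = refl

  stepR-cong : ∀ {Q Q'} → Q ≐ Q' → stepR H Q ≐ stepR H Q'
  stepR-cong {Q} {Q'} e w =
    trans (stepR≡ Q w)
      (trans (cong₂ _∨_ (e w) (some-cong λ f → cong (present H f ∧_)
                (cong₂ _∨_ (cong (_∧ (w == end₂ H f)) (e (end₁ H f)))
                           (cong (_∧ (w == end₁ H f)) (e (end₂ H f))))))
        (sym (stepR≡ Q' w)))

  stepR-edge : ∀ Q {x y} → Adj H x y → Q x ≡ true → stepR H Q y ≡ true
  stepR-edge Q {y = y} ad qx =
    trans (stepR≡ Q y)
      (trans (cong (Q y ∨_) (some-intro (edgeInto Q y) (edge ad) (crosses ad qx))) (∨-zeroʳ (Q y)))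
    where
    edge : ∀ {x y} → Adj H x y → Fin m
    edge (fwd f _) = f
    edge (bwd f _) = f
    crosses : ∀ {x y} (ad : Adj H x y) → Q x ≡ true → edgeInto Q y (edge ad) ≡ true
    crosses (fwd g pg) qx rewrite pg | qx | ==-refl (end₂ H g) = refl
    crosses (bwd g pg) qx rewrite pg | qx | ==-refl (end₁ H g) = ∨-zeroʳ _

  Stable : ℕ → Set
  Stable k = ∀ w → R (suc k) w ≡ R k w

  stable-or-grows : ∀ k → Stable k ⊎ (count (R k) < count (R (suc k)))
  stable-or-grows k with some (λ w → R (suc k) w ∧ not (R k w)) in eq
  ... | false = inj₁ λ w → same (R (suc k) w) (R k w) (stepR-grows (R k) w) (some-false _ eq w)
    where
    same : ∀ x y → (y ≡ true → x ≡ true) → x ∧ not y ≡ false → x ≡ y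
    same true true _ _ = refl
    same false false _ _ = refl
    same false true h _ = h refl
    same true false _ ()
  ... | true with some-witness _ eq
  ...   | w , d = inj₂ (count-strict (R k) (R (suc k)) (stepR-grows (R k)) w (new d) (proj₁ (∧-true d)))
    where
    new : ∀ {x y} → x ∧ not y ≡ true → y ≡ false
    new {true} {false} _ = refl

  stable-or-large : ∀ k → Stable k ⊎ (suc k ≤ count (R k))
  stable-or-large zero = inj₂ (count-pos (R zero) a (==-refl a))
  stable-or-large (suc k) with stable-or-grows k | stable-or-large k
  ... | inj₁ s | _ = inj₁ (stepR-cong s)
  ... | inj₂ _ | inj₁ s = inj₁ (stepR-cong s)
  ... | inj₂ lt | inj₂ le = inj₂ (ℕP.≤-trans (s≤s le) lt)

  stable-at-n : Stable n
  stable-at-n with stable-or-large n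
  ... | inj₁ s = s
  ... | inj₂ le = ⊥-elim (ℕP.<-irrefl refl (ℕP.≤-trans le (count-≤ (R n))))

  R-start : ∀ k → R k a ≡ true
  R-start zero = ==-refl a
  R-start (suc k) = stepR-grows (R k) a (R-start k)

  R-complete : ∀ {b} → Conn H a b → R n b ≡ true
  R-complete base = R-start n
  R-complete (step {y = y} p ad) = trans (sym (stable-at-n y)) (stepR-edge (R n) ad (R-complete p))

reach⇒conn : ∀ {n m} (K : Minor n m) a b → reach K a b ≡ true → Conn K a b
reach⇒conn {n} K a b = Reachability.R-sound K a n b

conn⇒reach : ∀ {n m} (K : Minor n m) {a b} → Conn K a b → reach K a b ≡ true
conn⇒reach K {a} = Reachability.R-complete K a

-- Counting the classes of an equivalence relation

-- comps counts the alive vertices that are least in their component.  We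
-- study this count abstractly, for a set A ⊆ Fin k and a boolean
-- equivalence relation r on Fin k.
record Equiv {k} (r : Fin k → Fin k → Bool) : Set where
  field
    rrefl : ∀ a → r a a ≡ true
    rsym : ∀ {a b} → r a b ≡ true → r b a ≡ true
    rtrans : ∀ {a b d} → r a b ≡ true → r b d ≡ true → r a d ≡ true

isRep : ∀ {k} → (Fin k → Bool) → (Fin k → Fin k → Bool) → Fin k → Bool
isRep A r w = A w ∧ not (some (λ u → A u ∧ (toℕ u <ᵇ toℕ w) ∧ r w u))

IsRep : ∀ {k} → (Fin k → Bool) → (Fin k → Fin k → Bool) → Fin k → Set
IsRep A r w = A w ≡ true × (∀ u → A u ≡ true → r w u ≡ true → toℕ w ≤ toℕ u)

classes : ∀ {k} → (Fin k → Bool) → (Fin k → Fin k → Bool) → ℕ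
classes A r = count (isRep A r)

comps≡classes : ∀ {n m} (H : Minor n m) → comps H ≡ classes (alive H) (reach H)
comps≡classes {n} H =
  trans (countFin≡count {n} _)
    (count-cong λ w → cong (λ z → alive H w ∧ not z) (anyFin≡some {n} _))

isRep-elim : ∀ {k} A r (w : Fin k) → isRep A r w ≡ true → IsRep A r w
isRep-elim A r w h with ∧-true h
... | aw , nn = aw , λ u au rwu → least u au rwu (some-false _ (not-true nn) u)
  where
  least : ∀ u → A u ≡ true → r w u ≡ true → (A u ∧ (toℕ u <ᵇ toℕ w) ∧ r w u) ≡ false →
    toℕ w ≤ toℕ u
  least u au rwu e with ℕP.<-cmp (toℕ u) (toℕ w)
  ... | tri< lt _ _ rewrite au | rwu | <ᵇ-intro lt = ⊥-elim (false≢true (sym e))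
  ... | tri≈ _ eq _ = ℕP.≤-reflexive (sym eq)
  ... | tri> _ _ gt = ℕP.<⇒≤ gt

no-smaller : ∀ {k} (A : Fin k → Bool) (r : Fin k → Fin k → Bool) (w : Fin k) →
  (∀ u → A u ≡ true → r w u ≡ true → toℕ w ≤ toℕ u) →
  ∀ u → (A u ∧ (toℕ u <ᵇ toℕ w) ∧ r w u) ≡ false
no-smaller A r w below u with A u in e1 | toℕ u <ᵇ toℕ w in e2 | r w u in e3
... | true | true | true = ⊥-elim (ℕP.<-irrefl refl (ℕP.<-≤-trans (<ᵇ-true e2) (below u e1 e3)))
... | false | _ | _ = refl
... | true | false | _ = refl
... | true | true | false = refl

isRep-intro : ∀ {k} A r (w : Fin k) → IsRep A r w → isRep A r w ≡ true
isRep-intro A r w (aw , below) rewrite aw | none⇒some-false _ (no-smaller A r w below) = refl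

isRep-false : ∀ {k} A r (w : Fin k) → (IsRep A r w → ⊥) → isRep A r w ≡ false
isRep-false A r w ne with isRep A r w in e
... | false = refl
... | true = ⊥-elim (ne (isRep-elim A r w e))

isRep-false-witness : ∀ {k} (A : Fin k → Bool) r w → A w ≡ true → isRep A r w ≡ false →
  Σ (Fin k) λ u → A u ≡ true × toℕ u < toℕ w × r w u ≡ true
isRep-false-witness A r w aw h rewrite aw with some-witness _ (not-false h)
  where
  not-false : ∀ {b} → not b ≡ false → b ≡ true
  not-false {true} _ = refl
... | u , e with ∧-true e
...   | au , e' with ∧-true e'
...     | lt , ru = u , au , <ᵇ-true lt , ru

least : ∀ {k} (P : Fin k → Bool) (i : Fin k) → P i ≡ true →
  Σ (Fin k) λ j → P j ≡ true × (∀ u → P u ≡ true → toℕ j ≤ toℕ u)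
least {suc k} P i h with P zero in e
... | true = zero , e , λ _ _ → z≤n
least {suc k} P zero h | false = ⊥-elim (false≢true (trans (sym e) h))
least {suc k} P (suc i) h | false with least (λ j → P (suc j)) i h
... | j , pj , mn = suc j , pj , above
  where
  above : ∀ u → P u ≡ true → toℕ (suc j) ≤ toℕ u
  above zero pu = ⊥-elim (false≢true (trans (sym e) pu))
  above (suc u) pu = s≤s (mn u pu)

fin-antisym : ∀ {k} {a b : Fin k} → toℕ a ≤ toℕ b → toℕ b ≤ toℕ a → a ≡ b
fin-antisym p q = toℕ-injective (ℕP.≤-antisym p q)

-- Moving one element of a predicate to another point keeps its count
-- (pass through the predicate with both points removed).
count-swap : ∀ {k} (p q : Fin k → Bool) (a b : Fin k) → a ≢ b →
  (∀ i → i ≢ a → i ≢ b → p i ≡ q i) →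
  p a ≡ true → q a ≡ false → p b ≡ false → q b ≡ true → count p ≡ count q
count-swap p q a b a≢b agree pa qa pb qb =
  ℕP.+-cancelʳ-≡ 0 _ _ (trans p→mid mid→q)
  where
  mid : Fin _ → Bool
  mid i = if i == a then false else p i
  mid-a : mid a ≡ false
  mid-a rewrite ==-refl a = refl
  mid-b : mid b ≡ false
  mid-b rewrite ==-≢ (λ e → a≢b (sym e)) = pb
  mid-q : ∀ i → i ≢ b → mid i ≡ q i
  mid-q i i≢b with i == a in e
  ... | true = subst (λ z → false ≡ q z) (sym (==-true e)) (sym qa)
  ... | false = agree i (==-false e) i≢b
  p→mid : count p + 0 ≡ count mid + 1
  p→mid = subst₂ (λ x y → count p + ind x ≡ count mid + ind y) mid-a pa
            (count-update p mid a λ i ne → sym (cong (λ z → if z then false else p i) (==-≢ ne)))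
  mid→q : count mid + 1 ≡ count q + 0
  mid→q = subst₂ (λ x y → count mid + ind x ≡ count q + ind y) qb mid-b
            (count-update mid q b mid-q)

classes-ext : ∀ {k} (A A' : Fin k → Bool) (r r' : Fin k → Fin k → Bool) → A ≐ A' →
  (∀ a b → A a ≡ true → A b ≡ true → r a b ≡ r' a b) → classes A r ≡ classes A' r'
classes-ext A A' r r' eA er = count-cong same
  where
  on-A : ∀ {w} {X : Set} → (A w ≡ true → A' w ≡ true → X) → (A w ≡ false → A' w ≡ false → X) → X
  on-A {w} t f with A w in e1 | A' w in e2
  ... | true | true = t refl refl
  ... | false | false = f refl refl
  ... | true | false = ⊥-elim (false≢true (trans (sym e2) (trans (sym (eA w)) e1)))
  ... | false | true = ⊥-elim (false≢true (trans (sym e1) (trans (eA w) e2)))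
  same : ∀ w → isRep A r w ≡ isRep A' r' w
  same w = on-A {w}
    (λ a a' → cong₂ (λ x y → x ∧ not y) (trans a (sym a'))
      (some-cong λ u → on-A {u}
        (λ b b' → cong₂ (λ x y → x ∧ (toℕ u <ᵇ toℕ w) ∧ y) (trans b (sym b')) (er w u a b))
        (λ b b' → trans (∧-falseˡ b) (sym (∧-falseˡ b')))))
    (λ a a' → trans (∧-falseˡ a) (sym (∧-falseˡ a')))

-- Removing from A a vertex v that is r-related to another element u of A
-- does not change the number of classes: if v represented its class, the
-- least remaining element q of that class takes over.
module RemoveVertex {k} (r : Fin k → Fin k → Bool) (eqv : Equiv r) (A : Fin k → Bool) (u v : Fin k)
  (Av : A v ≡ true) (Au : A u ≡ true) (u≢v : u ≢ v) (ruv : r u v ≡ true) where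
  open Equiv eqv

  A' : Fin k → Bool
  A' w = A w ∧ not (w == v)

  A'-intro : ∀ {w} → A w ≡ true → w ≢ v → A' w ≡ true
  A'-intro {w} aw ne rewrite aw | ==-≢ ne = refl

  A'-elim : ∀ {w} → A' w ≡ true → A w ≡ true × w ≢ v
  A'-elim h with ∧-true h
  ... | aw , nv = aw , ==-false (not-true nv)

  rep-restrict : ∀ {w} → IsRep A r w → w ≢ v → IsRep A' r w
  rep-restrict (aw , mn) ne = A'-intro aw ne , λ z az rz → mn z (proj₁ (A'-elim az)) rz

  rep-extend : ∀ {w} → IsRep A' r w → (r w v ≡ true → toℕ w ≤ toℕ v) → IsRep A r w
  rep-extend {w} (aw , mn) below-v = proj₁ (A'-elim aw) , below
    where
    below : ∀ z → A z ≡ true → r w z ≡ true → toℕ w ≤ toℕ z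
    below z az rz with z == v in e
    ... | true = subst (λ t → toℕ w ≤ toℕ t) (sym (==-true e)) (below-v (subst (λ t → r w t ≡ true) (==-true e) rz))
    ... | false = mn z (A'-intro az (==-false e)) rz

  -- v is not a representative: the representatives of A and A' coincide.
  unchanged : isRep A r v ≡ false → classes A' r ≡ classes A r
  unchanged ev with isRep-false-witness A r v Av ev
  ... | u0 , au0 , lt , rv0 = count-cong λ w → bool-ext
      (λ h → let P = isRep-elim A' r w h in
        isRep-intro A r w (rep-extend P λ rwv →
          ℕP.<⇒≤ (ℕP.≤-<-trans (proj₂ P u0 (A'-intro au0 λ e → ℕP.<-irrefl (cong toℕ e) lt) (rtrans rwv rv0)) lt)))
      (λ h → isRep-intro A' r w (rep-restrict (isRep-elim A r w h)
        λ e → false≢true (trans (sym ev) (subst (λ t → isRep A r t ≡ true) e h))))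

  replaced : isRep A r v ≡ true → classes A' r ≡ classes A r
  replaced ev = sym (count-swap (isRep A r) (isRep A' r) v q v≢q others ev
                       (isRep-false A' r v (λ P → proj₂ (A'-elim (proj₁ P)) refl))
                       (isRep-false A r q q-not-rep) (isRep-intro A' r q q-rep))
    where
    Pv = isRep-elim A r v ev
    lq = least (λ z → A' z ∧ r v z) u (trans (cong (_∧ r v u) (A'-intro Au u≢v)) (rsym ruv))
    q = proj₁ lq
    A'q : A' q ≡ true
    A'q = proj₁ (∧-true (proj₁ (proj₂ lq)))
    rvq : r v q ≡ true
    rvq = proj₂ (∧-true (proj₁ (proj₂ lq)))
    q-least : ∀ z → A' z ≡ true → r v z ≡ true → toℕ q ≤ toℕ z
    q-least z az rz = proj₂ (proj₂ lq) z (trans (cong (_∧ r v z) az) rz)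
    v≢q : v ≢ q
    v≢q e = proj₂ (A'-elim A'q) (sym e)
    q-rep : IsRep A' r q
    q-rep = A'q , λ z az rz → q-least z az (rtrans rvq rz)
    q-not-rep : IsRep A r q → ⊥
    q-not-rep (_ , mn) = v≢q (fin-antisym (proj₂ Pv q (proj₁ (A'-elim A'q)) rvq) (mn v Av (rsym rvq)))
    others : ∀ w → w ≢ v → w ≢ q → isRep A r w ≡ isRep A' r w
    others w nv nq with r w v in e
    ... | true = trans (isRep-false A r w (λ P → nv (fin-antisym (proj₂ P v Av e) (proj₂ Pv w (proj₁ P) (rsym e)))))
                   (sym (isRep-false A' r w (λ P →
                     nq (fin-antisym (proj₂ P q A'q (rtrans e rvq)) (q-least w (proj₁ P) (rsym e))))))
    ... | false = bool-ext (λ h → isRep-intro A' r w (rep-restrict (isRep-elim A r w h) nv))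
                           (λ h → isRep-intro A r w (rep-extend (isRep-elim A' r w h)
                             λ t → ⊥-elim (false≢true (trans (sym e) t))))

  classes-remove : classes A' r ≡ classes A r
  classes-remove with isRep A r v in ev
  ... | false = unchanged ev
  ... | true = replaced ev

Touches : ∀ {k} → (Fin k → Fin k → Bool) → Fin k → Fin k → Fin k → Set
Touches r u v a = r a u ≡ true ⊎ r a v ≡ true

-- Merging the distinct classes of u and v (r' is r with these two classes
-- joined) lowers the number of classes by one: of the two representatives
-- p < q, only q stops being one.
module MergeClasses {k} (r r' : Fin k → Fin k → Bool) (eqv : Equiv r) (eqv' : Equiv r')
  (A : Fin k → Bool) (r⊆r' : ∀ {a b} → r a b ≡ true → r' a b ≡ true) where
  open Equiv eqv
  open Equiv eqv' using () renaming (rsym to rsym'; rtrans to rtrans')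

  merge-ordered : ∀ (u v p q : Fin k) → r' u v ≡ true →
    (∀ a b → r' a b ≡ true → r a b ≡ true ⊎ (Touches r u v a × Touches r u v b)) →
    A p ≡ true → r u p ≡ true →
    A q ≡ true → r v q ≡ true → (∀ z → A z ≡ true → r v z ≡ true → toℕ q ≤ toℕ z) →
    toℕ p < toℕ q → classes A r' + 1 ≡ classes A r + 0
  merge-ordered u v p q r'uv split Ap rup Aq rvq q-least p<q =
    subst (λ t → count (isRep A r') + ind t ≡ count (isRep A r) + 0) q-rep
      (subst (λ t → count (isRep A r') + ind (isRep A r q) ≡ count (isRep A r) + ind t) q-not-rep'
        (count-update (isRep A r') (isRep A r) q others))
    where
    toU : ∀ {a} → Touches r u v a → r' a u ≡ true
    toU (inj₁ h) = r⊆r' h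
    toU (inj₂ h) = rtrans' (r⊆r' h) (rsym' r'uv)
    join : ∀ a b → Touches r u v a → Touches r u v b → r' a b ≡ true
    join a b ta tb = rtrans' (toU ta) (rsym' (toU tb))
    q-rep : isRep A r q ≡ true
    q-rep = isRep-intro A r q (Aq , λ z az rz → q-least z az (rtrans rvq rz))
    q-not-rep' : isRep A r' q ≡ false
    q-not-rep' = isRep-false A r' q λ P →
      ℕP.<-irrefl refl (ℕP.<-≤-trans p<q (proj₂ P p Ap (join q p (inj₂ (rsym rvq)) (inj₁ (rsym rup)))))
    others : ∀ w → w ≢ q → isRep A r' w ≡ isRep A r w
    others w w≢q = bool-ext
      (λ h → let P = isRep-elim A r' w h in isRep-intro A r w (proj₁ P , λ z az rz → proj₂ P z az (r⊆r' rz)))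
      (λ h → let P = isRep-elim A r w h in isRep-intro A r' w (proj₁ P , λ z az rz → below P z az (split w z rz)))
      where
      below : IsRep A r w → ∀ z → A z ≡ true → r w z ≡ true ⊎ (Touches r u v w × Touches r u v z) → toℕ w ≤ toℕ z
      below P z az (inj₁ h) = proj₂ P z az h
      below P z az (inj₂ (inj₂ wv , _)) =
        ⊥-elim (w≢q (fin-antisym (proj₂ P q Aq (rtrans wv rvq)) (q-least w (proj₁ P) (rsym wv))))
      below P z az (inj₂ (inj₁ wu , inj₁ zu)) = proj₂ P z az (rtrans wu (rsym zu))
      below P z az (inj₂ (inj₁ wu , inj₂ zv)) =
        ℕP.<⇒≤ (ℕP.≤-<-trans (proj₂ P p Ap (rtrans wu rup)) (ℕP.<-≤-trans p<q (q-least z az (rsym zv))))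

  module _ (u v : Fin k) (Au : A u ≡ true) (Av : A v ≡ true) (ruv : r u v ≡ false) (r'uv : r' u v ≡ true)
    (split : ∀ a b → r' a b ≡ true → r a b ≡ true ⊎ (Touches r u v a × Touches r u v b)) where

    rep-of : ∀ z → A z ≡ true → Σ (Fin k) λ p → A p ≡ true × r z p ≡ true ×
                                   (∀ y → A y ≡ true → r z y ≡ true → toℕ p ≤ toℕ y)
    rep-of z Az with least (λ y → A y ∧ r z y) z (trans (cong (_∧ r z z) Az) (rrefl z))
    ... | p , Ap∧ , p-least = p , proj₁ (∧-true Ap∧) , proj₂ (∧-true Ap∧) ,
                               λ y ay ry → p-least y (trans (cong (_∧ r z y) ay) ry)

    swap-touch : ∀ {a} → Touches r u v a → Touches r v u a
    swap-touch (inj₁ x) = inj₂ x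
    swap-touch (inj₂ x) = inj₁ x

    split' : ∀ a b → r' a b ≡ true → r a b ≡ true ⊎ (Touches r v u a × Touches r v u b)
    split' a b h with split a b h
    ... | inj₁ x = inj₁ x
    ... | inj₂ (x , y) = inj₂ (swap-touch x , swap-touch y)

    classes-merge : classes A r' + 1 ≡ classes A r
    classes-merge with rep-of u Au | rep-of v Av
    ... | p , Ap , rup , p-least | q , Aq , rvq , q-least =
      trans (ordered (ℕP.<-cmp (toℕ p) (toℕ q))) (ℕP.+-identityʳ _)
      where
      ordered : Tri (toℕ p < toℕ q) (toℕ p ≡ toℕ q) (toℕ q < toℕ p) → classes A r' + 1 ≡ classes A r + 0
      ordered (tri< lt _ _) = merge-ordered u v p q r'uv split Ap rup Aq rvq q-least lt
      ordered (tri> _ _ gt) = merge-ordered v u q p (rsym' r'uv) split' Aq rvq Ap rup p-least gt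
      ordered (tri≈ _ eq _) = ⊥-elim (false≢true (trans (sym ruv)
        (rtrans rup (rtrans (subst (λ t → r p t ≡ true) (toℕ-injective eq) (rrefl p)) (rsym rvq)))))

classes-discrete : ∀ {k} (A : Fin k → Bool) r → (∀ a b → r a b ≡ true → a ≡ b) → classes A r ≡ count A
classes-discrete A r h = count-cong λ w → bool-ext (λ e → proj₁ (isRep-elim A r w e))
  (λ e → isRep-intro A r w (e , λ z _ rz → ℕP.≤-reflexive (cong toℕ (h w z rz))))

classes-pos : ∀ {k} (A : Fin k → Bool) r i → A i ≡ true → 1 ≤ classes A r
classes-pos A r i Ai with least A i Ai
... | j , Aj , j-least = count-pos (isRep A r) j (isRep-intro A r j (Aj , λ u Au _ → j-least u Au))

-- Components under deletion and contraction

module _ {n m : ℕ} where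

  reach-equiv : (K : Minor n m) → Equiv (reach K)
  reach-equiv K = record
    { rrefl = λ a → conn⇒reach K base
    ; rsym = λ {a} {b} h → conn⇒reach K (conn-sym (reach⇒conn K a b h))
    ; rtrans = λ {a} {b} {d} h h' → conn⇒reach K (conn-trans (reach⇒conn K a b h) (reach⇒conn K b d h')) }

  comps-via : ∀ (K K' : Minor n m) → alive K ≐ alive K' →
    (∀ {x y} → Adj K x y → Conn K' x y) → (∀ {x y} → Adj K' x y → Conn K x y) → comps K ≡ comps K'
  comps-via K K' eA to from =
    trans (comps≡classes K)
      (trans (classes-ext (alive K) (alive K') (reach K) (reach K') eA (λ a b _ _ → same-reach a b))
        (sym (comps≡classes K')))
    where
    same-reach : ∀ a b → reach K a b ≡ reach K' a b
    same-reach a b = bool-ext (λ e → conn⇒reach K' (conn-lift to (reach⇒conn K a b e)))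
                              (λ e → conn⇒reach K (conn-lift from (reach⇒conn K' a b e)))

  adj-redundant : ∀ (K K' : Minor n m) → (∀ f → hends K f ≡ hends K' f) →
    (∀ f → present K f ≡ true → present K' f ≡ true ⊎ Conn K' (end₁ K f) (end₂ K f)) →
    ∀ {x y} → Adj K x y → Conn K' x y
  adj-redundant K K' eh hp (fwd f pr) with hp f pr
  ... | inj₁ pr' = conn1 (subst (λ ends → Adj K' (proj₁ ends) (proj₂ ends)) (sym (eh f)) (fwd f pr'))
  ... | inj₂ c = c
  adj-redundant K K' eh hp (bwd f pr) with hp f pr
  ... | inj₁ pr' = conn1 (subst (λ ends → Adj K' (proj₂ ends) (proj₁ ends)) (sym (eh f)) (bwd f pr'))
  ... | inj₂ c = conn-sym c

  comps-redundant : ∀ (K K' : Minor n m) → alive K ≐ alive K' → (∀ f → hends K f ≡ hends K' f) →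
    (∀ f → present K' f ≡ true → present K f ≡ true) →
    (∀ f → present K f ≡ true → present K' f ≡ true ⊎ Conn K' (end₁ K f) (end₂ K f)) →
    comps K ≡ comps K'
  comps-redundant K K' eA eh sub sup = comps-via K K' eA (adj-redundant K K' eh sup)
    (adj-redundant K' K (λ f → sym (eh f)) (λ f pr → inj₁ (sub f pr)))

  comps-present-cong : ∀ (K K' : Minor n m) → present K ≐ present K' →
    comps (record K { present = present K }) ≡ comps (record K { present = present K' })
  comps-present-cong K K' eq = comps-redundant _ _ (λ _ → refl) (λ _ → refl)
    (λ f pr → trans (eq f) pr) (λ f pr → inj₁ (trans (sym (eq f)) pr))

  -- Contracting a present non-loop edge uv keeps comps: walks are carried
  -- back and forth by renaming v to u, and v was in the component of u.
  module Contraction (K : Minor n m) (e : Fin m) where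
    u = end₁ K e
    v = end₂ K e

    ren : Fin n → Fin n
    ren w = if w == v then u else w

    ren-v : ren v ≡ u
    ren-v rewrite ==-refl v = refl

    ren-other : ∀ {w} → w ≢ v → ren w ≡ w
    ren-other ne rewrite ==-≢ ne = refl

    module _ (pe : present K e ≡ true) (u≢v : u ≢ v) where
      to-ren : ∀ w → Conn K (ren w) w
      to-ren w with w == v in eq
      ... | true = subst (Conn K u) (sym (==-true eq)) (conn1 (fwd e pe))
      ... | false = base

      from-contraction : ∀ {x y} → Adj (contract K e) x y → Conn K x y
      from-contraction (fwd f pr) =
        conn-trans (to-ren (end₁ K f)) (conn-trans (conn1 (fwd f (proj₁ (∧-true pr)))) (conn-sym (to-ren (end₂ K f))))
      from-contraction (bwd f pr) =
        conn-trans (to-ren (end₂ K f)) (conn-trans (conn1 (bwd f (proj₁ (∧-true pr)))) (conn-sym (to-ren (end₁ K f))))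

      edge-to-contraction : ∀ f → present K f ≡ true → Conn (contract K e) (ren (end₁ K f)) (ren (end₂ K f))
      edge-to-contraction f pr with f == e in eq
      ... | true = subst (λ a → Conn (contract K e) (ren (end₁ K a)) (ren (end₂ K a))) (sym (==-true eq))
                     (subst₂ (Conn (contract K e)) (sym (ren-other u≢v)) (sym ren-v) base)
      ... | false = conn1 (fwd f present')
        where
        present' : present (contract K e) f ≡ true
        present' rewrite pr | eq = refl

      to-contraction : ∀ {x y} → Adj K x y → Conn (contract K e) (ren x) (ren y)
      to-contraction (fwd f pr) = edge-to-contraction f pr
      to-contraction (bwd f pr) = conn-sym (edge-to-contraction f pr)

      contract-comps : alive K u ≡ true → alive K v ≡ true → comps (contract K e) ≡ comps K
      contract-comps au av =
        trans (comps≡classes (contract K e))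
          (trans (classes-ext _ _ (reach (contract K e)) (reach K) (λ _ → refl) same-reach)
            (trans (RemoveVertex.classes-remove (reach K) (reach-equiv K) (alive K) u v av au u≢v
                      (conn⇒reach K (conn1 (fwd e pe))))
              (sym (comps≡classes K))))
        where
        not-v : ∀ {w} → alive (contract K e) w ≡ true → w ≢ v
        not-v h = ==-false (not-true (proj₂ (∧-true h)))
        same-reach : ∀ a b → alive (contract K e) a ≡ true → alive (contract K e) b ≡ true →
          reach (contract K e) a b ≡ reach K a b
        same-reach a b ha hb = bool-ext
          (λ h → conn⇒reach K (conn-lift from-contraction (reach⇒conn (contract K e) a b h)))
          (λ h → conn⇒reach (contract K e)
                   (subst₂ (Conn (contract K e)) (ren-other (not-v ha)) (ren-other (not-v hb))
                     (conn-map ren to-contraction (reach⇒conn K a b h))))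

  -- Contracting an absent edge uv between two different components
  -- lowers comps by one: it equals contracting uv in K + uv, and adding uv
  -- merges the components of u and v.
  module AddEdge (K : Minor n m) (e : Fin m) where
    K+ : Minor n m
    K+ = record K { present = λ f → present K f ∨ (f == e) }
    u = end₁ K e
    v = end₂ K e

    e∈K+ : present K+ e ≡ true
    e∈K+ rewrite ==-refl e = ∨-zeroʳ (present K e)

    K⊆K+ : ∀ {x y} → Adj K x y → Adj K+ x y
    K⊆K+ (fwd f pr) = fwd f (cong (_∨ (f == e)) pr)
    K⊆K+ (bwd f pr) = bwd f (cong (_∨ (f == e)) pr)

    InUV : Fin n → Set
    InUV z = Conn K z u ⊎ Conn K z v

    InUV-step : ∀ {x y} → Adj K x y → InUV x → InUV y
    InUV-step ad (inj₁ c) = inj₁ (conn-trans (conn1 (adj-sym ad)) c)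
    InUV-step ad (inj₂ c) = inj₂ (conn-trans (conn1 (adj-sym ad)) c)

    either-end : ∀ {a x y} → (Conn K a x ⊎ (InUV a × InUV x)) → x ≡ u ⊎ x ≡ v → y ≡ u ⊎ y ≡ v →
      Conn K a y ⊎ (InUV a × InUV y)
    either-end {y = y} ih hx hy = inj₂ (start ih hx , at-end hy)
      where
      start : ∀ {a x} → (Conn K a x ⊎ (InUV a × InUV x)) → x ≡ u ⊎ x ≡ v → InUV a
      start (inj₁ c) (inj₁ refl) = inj₁ c
      start (inj₁ c) (inj₂ refl) = inj₂ c
      start (inj₂ (b , _)) _ = b
      at-end : y ≡ u ⊎ y ≡ v → InUV y
      at-end (inj₁ refl) = inj₁ base
      at-end (inj₂ refl) = inj₂ base

    -- A present edge f ≠ e of K + uv (with f == e already evaluated to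
    -- false) is an edge of K.
    old-edge : ∀ {f} → present K f ∨ false ≡ true → present K f ≡ true
    old-edge pr = trans (sym (∨-identityʳ _)) pr

    same-present : ∀ f → present (contract K e) f ≡ present (contract K+ e) f
    same-present f with f == e
    ... | true = trans (∧-zeroʳ _) (sym (∧-zeroʳ _))
    ... | false = cong (_∧ true) (sym (∨-identityʳ _))

    split-walk : ∀ {a b} → Conn K+ a b → Conn K a b ⊎ (InUV a × InUV b)
    split-walk base = inj₁ base
    split-walk (step p (fwd f pr)) with f == e in eq | split-walk p
    ... | true | ih = either-end ih (inj₁ (cong (end₁ K) (==-true eq))) (inj₂ (cong (end₂ K) (==-true eq)))
    ... | false | inj₁ c = inj₁ (step c (fwd f (old-edge pr)))
    ... | false | inj₂ (ba , bx) = inj₂ (ba , InUV-step (fwd f (old-edge pr)) bx)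
    split-walk (step p (bwd f pr)) with f == e in eq | split-walk p
    ... | true | ih = either-end ih (inj₂ (cong (end₂ K) (==-true eq))) (inj₁ (cong (end₁ K) (==-true eq)))
    ... | false | inj₁ c = inj₁ (step c (bwd f (old-edge pr)))
    ... | false | inj₂ (ba , bx) = inj₂ (ba , InUV-step (bwd f (old-edge pr)) bx)

    module _ (absent : present K e ≡ false) (u≢v : u ≢ v) (au : alive K u ≡ true) (av : alive K v ≡ true)
             (apart : Conn K u v → ⊥) where

      contract-absent-comps : comps (contract K e) + 1 ≡ comps K
      contract-absent-comps =
        trans (cong (_+ 1) (trans same-contraction (trans (Contraction.contract-comps K+ e e∈K+ u≢v au av)
                                                      (comps≡classes K+))))
          (trans (MergeClasses.classes-merge (reach K) (reach K+) (reach-equiv K) (reach-equiv K+) (alive K)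
                    (λ {a} {b} h → conn⇒reach K+ (conn-lift (λ ad → conn1 (K⊆K+ ad)) (reach⇒conn K a b h)))
                    u v au av u-v-apart (conn⇒reach K+ (conn1 (fwd e e∈K+))) split-reach)
            (sym (comps≡classes K)))
        where
        same-contraction : comps (contract K e) ≡ comps (contract K+ e)
        same-contraction = comps-present-cong (contract K e) (contract K+ e) same-present
        u-v-apart : reach K u v ≡ false
        u-v-apart with reach K u v in eq
        ... | false = refl
        ... | true = ⊥-elim (apart (reach⇒conn K u v eq))
        touches : ∀ {z} → InUV z → Touches (reach K) u v z
        touches (inj₁ c) = inj₁ (conn⇒reach K c)
        touches (inj₂ c) = inj₂ (conn⇒reach K c)
        split-reach : ∀ a b → reach K+ a b ≡ true →
          reach K a b ≡ true ⊎ (Touches (reach K) u v a × Touches (reach K) u v b)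
        split-reach a b h with split-walk (reach⇒conn K+ a b h)
        ... | inj₁ c = inj₁ (conn⇒reach K c)
        ... | inj₂ (x , y) = inj₂ (touches x , touches y)

  isthmus-apart : ∀ (K : Minor n m) e → isIsthmus K e ≡ true → Conn (delete K e) (end₁ K e) (end₂ K e) → ⊥
  isthmus-apart K e h c with ∧-true {present K e} {comps K <ᵇ comps (delete K e)} h
  ... | _ , lt = ℕP.<-irrefl refl (<ᵇ-true {comps K} (subst (λ t → (comps K <ᵇ t) ≡ true) (sym same) lt))
    where
    same : comps K ≡ comps (delete K e)
    same = comps-redundant K (delete K e) (λ _ → refl) (λ _ → refl) (λ f pr → proj₁ (∧-true pr)) kept
      where
      kept : ∀ f → present K f ≡ true → present (delete K e) f ≡ true ⊎ Conn (delete K e) (end₁ K f) (end₂ K f)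
      kept f pr with f == e in eq
      ... | true = inj₂ (subst (λ g → Conn (delete K e) (end₁ K g) (end₂ K g)) (sym (==-true eq)) c)
      ... | false rewrite pr = inj₁ refl

-- The run invariant

data Classified {n m} (S : Sub m) (K : Minor n m) (e : Fin m) : EType → Set where
  cL : isLoop K e ≡ true → Classified S K e L
  cI : isLoop K e ≡ false → isIsthmus K e ≡ true → Classified S K e I
  cSi : isLoop K e ≡ false → isIsthmus K e ≡ false → (e ∈ₛ S) ≡ true → Classified S K e Si
  cSe : isLoop K e ≡ false → isIsthmus K e ≡ false → (e ∈ₛ S) ≡ false → Classified S K e Se

classified : ∀ {n m} (S : Sub m) (K : Minor n m) e → Classified S K e (classify S K e)
classified S K e with isLoop K e in l
... | true = cL l
... | false with isIsthmus K e in i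
...   | true = cI l i
...   | false with e ∈ₛ S in s
...     | true = cSi l i s
...     | false = cSe l i s

apply-present : ∀ {n m} (K : Minor n m) e t f → present (apply K e t) f ≡ present K f ∧ not (f == e)
apply-present K e Se f = refl
apply-present K e L f = refl
apply-present K e Si f = refl
apply-present K e I f = refl

_∣_ : ∀ {n m} → Minor n m → Sub m → Minor n m
K ∣ S = record K { present = λ f → present K f ∧ (f ∈ₛ S) }

-- Every present edge has alive ends (true of G, kept by the operations).
EndsAlive : ∀ {n m} → Minor n m → Set
EndsAlive K = ∀ f → present K f ≡ true → alive K (end₁ K f) ≡ true × alive K (end₂ K f) ≡ true

countL : ∀ {A : Set} → (A → Bool) → List A → ℕ
countL P [] = 0
countL P (x ∷ xs) = ind (P x) + countL P xs

Entry : ℕ → Set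
Entry m = Fin m × EType

contracting : ∀ {m} → Entry m → Bool
contracting (_ , Si) = true
contracting (_ , I) = true
contracting _ = false

outerIsthmus : ∀ {m} → Sub m → Entry m → Bool
outerIsthmus S (e , I) = not (e ∈ₛ S)
outerIsthmus S _ = false

inS : ∀ {m} → Sub m → Entry m → Bool
inS S (e , _) = e ∈ₛ S

sizeIn : ∀ {n m} → Sub m → Minor n m → ℕ
sizeIn S K = count (λ f → present K f ∧ (f ∈ₛ S))

RunInvariant : ∀ {n m} → Sub m → Minor n m → List (Entry m) → Set
RunInvariant S K h =
  (comps (K ∣ S) + countL contracting h ≡ count (alive K) + countL (outerIsthmus S) h) ×
  (sizeIn S K ≡ countL (inS S) h)

StepEffect : ∀ {n m} → Sub m → Minor n m → Entry m → Set
StepEffect S K (e , t) =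
  (count (alive K) ≡ count (alive (apply K e t)) + ind (contracting (e , t))) ×
  (comps (K ∣ S) ≡ comps (apply K e t ∣ S) + ind (outerIsthmus S (e , t)))

module OneStep {n m} (S : Sub m) (K : Minor n m) (e : Fin m) (pe : present K e ≡ true)
  (ends-alive : EndsAlive K) where
  u = end₁ K e
  v = end₂ K e

  au : alive K u ≡ true
  au = proj₁ (ends-alive e pe)
  av : alive K v ≡ true
  av = proj₂ (ends-alive e pe)

  non-loop : isLoop K e ≡ false → u ≢ v
  non-loop h rewrite pe = ==-false h

  loop-ends : isLoop K e ≡ true → u ≡ v
  loop-ends h rewrite pe = ==-true h

  delete-comps : ((e ∈ₛ S) ≡ false ⊎ u ≡ v) → comps (K ∣ S) ≡ comps (delete K e ∣ S)
  delete-comps loop-or-out = comps-redundant (K ∣ S) (delete K e ∣ S) (λ _ → refl) (λ _ → refl)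
      (λ f pr → drop-middle {present K f} pr) (kept loop-or-out)
    where
    kept : ((e ∈ₛ S) ≡ false ⊎ u ≡ v) → ∀ f → present (K ∣ S) f ≡ true →
      present (delete K e ∣ S) f ≡ true ⊎ Conn (delete K e ∣ S) (end₁ K f) (end₂ K f)
    kept loop-or-out f pr with f == e in eq | loop-or-out
    ... | false | _ rewrite ∧-identityʳ (present K f) = inj₁ pr
    ... | true | inj₂ loop =
      inj₂ (subst (λ g → Conn (delete K e ∣ S) (end₁ K g) (end₂ K g)) (sym (==-true eq)) (conn-≡ loop))
    ... | true | inj₁ out = ⊥-elim (false≢true (trans (sym out)
            (subst (λ g → (g ∈ₛ S) ≡ true) (==-true eq) (proj₂ (∧-true {present K f} pr)))))

  contract-restrict : comps (contract K e ∣ S) ≡ comps (contract (K ∣ S) e)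
  contract-restrict = comps-present-cong (contract K e ∣ S) (contract (K ∣ S) e)
    λ f → ∧-swapʳ (present K f) (not (f == e)) (f ∈ₛ S)

  contract-alive : count (alive K) ≡ count (alive (contract K e)) + 1
  contract-alive = trans (sym (ℕP.+-identityʳ _))
    (subst₂ (λ a b → count (alive K) + ind a ≡ count (alive (contract K e)) + ind b) v-dead av
      (count-update (alive K) (alive (contract K e)) v
        λ i ne → sym (trans (cong (λ z → alive K i ∧ not z) (==-≢ ne)) (∧-identityʳ _))))
    where
    v-dead : alive (contract K e) v ≡ false
    v-dead rewrite ==-refl v = ∧-zeroʳ (alive K v)

  contract-ends-alive : u ≢ v → EndsAlive (contract K e)
  contract-ends-alive u≢v f pr = renamed (end₁ K f) (proj₁ (ends-alive f (proj₁ (∧-true pr)))) ,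
                                 renamed (end₂ K f) (proj₂ (ends-alive f (proj₁ (∧-true pr))))
    where
    renamed : ∀ x → alive K x ≡ true → alive (contract K e) (Contraction.ren K e x) ≡ true
    renamed x ax with x == v in eq
    ... | true rewrite au | ==-≢ u≢v = refl
    ... | false rewrite ax | eq = refl

  apply-ends-alive : ∀ {t} → Classified S K e t → EndsAlive (apply K e t)
  apply-ends-alive (cL _) f pr = ends-alive f (proj₁ (∧-true pr))
  apply-ends-alive (cSe _ _ _) f pr = ends-alive f (proj₁ (∧-true pr))
  apply-ends-alive (cSi l _ _) = contract-ends-alive (non-loop l)
  apply-ends-alive (cI l _) = contract-ends-alive (non-loop l)

  contract-inside : isLoop K e ≡ false → (e ∈ₛ S) ≡ true → comps (K ∣ S) ≡ comps (contract K e ∣ S)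
  contract-inside l s =
    sym (trans contract-restrict (Contraction.contract-comps (K ∣ S) e e∈K∣S (non-loop l) au av))
    where
    e∈K∣S : present K e ∧ (e ∈ₛ S) ≡ true
    e∈K∣S rewrite pe | s = refl

  contract-outside : isLoop K e ≡ false → isIsthmus K e ≡ true → (e ∈ₛ S) ≡ false →
    comps (K ∣ S) ≡ comps (contract K e ∣ S) + 1
  contract-outside l i s = sym (trans (cong (_+ 1) contract-restrict)
      (AddEdge.contract-absent-comps (K ∣ S) e absent (non-loop l) au av apart))
    where
    absent : present K e ∧ (e ∈ₛ S) ≡ false
    absent rewrite s = ∧-zeroʳ _
    in-delete : ∀ {x y} → Adj (K ∣ S) x y → Conn (delete K e) x y
    in-delete = adj-redundant (K ∣ S) (delete K e) (λ _ → refl) edge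
      where
      edge : ∀ f → present (K ∣ S) f ≡ true → present (delete K e) f ≡ true ⊎ Conn (delete K e) (end₁ K f) (end₂ K f)
      edge f pr with f == e in eq
      ... | false rewrite ∧-identityʳ (present K f) = inj₁ (proj₁ (∧-true pr))
      ... | true = ⊥-elim (false≢true (trans (sym s)
                     (subst (λ g → (g ∈ₛ S) ≡ true) (==-true eq) (proj₂ (∧-true {present K f} pr)))))
    apart : Conn (K ∣ S) u v → ⊥
    apart c = isthmus-apart K e i (conn-lift in-delete c)

  step-effect : ∀ {t} → Classified S K e t → StepEffect S K (e , t)
  step-effect (cL l) = sym (ℕP.+-identityʳ _) , trans (delete-comps (inj₂ (loop-ends l))) (sym (ℕP.+-identityʳ _))
  step-effect (cSe _ _ s) = sym (ℕP.+-identityʳ _) , trans (delete-comps (inj₁ s)) (sym (ℕP.+-identityʳ _))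
  step-effect (cSi l _ s) = contract-alive , trans (contract-inside l s) (sym (ℕP.+-identityʳ _))
  step-effect (cI l i) with e ∈ₛ S in s
  ... | true = contract-alive , trans (contract-inside l s) (sym (ℕP.+-identityʳ _))
  ... | false = contract-alive , contract-outside l i s

  step-size : ∀ t → sizeIn S K ≡ ind (e ∈ₛ S) + sizeIn S (apply K e t)
  step-size t = ℕP.+-cancelʳ-≡ 0 _ _
    (trans (subst₂ (λ a b → sizeIn S K + ind a ≡ sizeIn S (apply K e t) + ind b)
              gone kept
              (count-update _ _ e λ f ne → sym (cong (_∧ (f ∈ₛ S))
                 (trans (apply-present K e t f) (trans (cong (λ z → present K f ∧ not z) (==-≢ ne)) (∧-identityʳ _))))))
       (trans (ℕP.+-comm _ (ind (e ∈ₛ S))) (sym (ℕP.+-identityʳ _))))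
    where
    gone : present (apply K e t) e ∧ (e ∈ₛ S) ≡ false
    gone rewrite apply-present K e t e | ==-refl e | ∧-zeroʳ (present K e) = refl
    kept : present K e ∧ (e ∈ₛ S) ≡ (e ∈ₛ S)
    kept rewrite pe = refl

invariant-cons : ∀ {n m} (S : Sub m) (K : Minor n m) e t rest →
  StepEffect S K (e , t) →
  sizeIn S K ≡ ind (e ∈ₛ S) + sizeIn S (apply K e t) →
  RunInvariant S (apply K e t) rest → RunInvariant S K ((e , t) ∷ rest)
invariant-cons S K e t rest (alive-step , comps-step) size-step (comps-rest , size-rest) =
  components , trans size-step (cong (_+_ (ind (e ∈ₛ S))) size-rest)
  where
  open ≡-Reasoning
  open +-*-Solver using (solve; _:+_; _:=_)
  k = ind (contracting (e , t))
  o = ind (outerIsthmus S (e , t))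
  C = countL contracting rest
  O = countL (outerIsthmus S) rest
  cK' = comps (apply K e t ∣ S)
  aK' = count (alive (apply K e t))
  components : comps (K ∣ S) + (k + C) ≡ count (alive K) + (o + O)
  components = begin
    comps (K ∣ S) + (k + C)  ≡⟨ cong (_+ (k + C)) comps-step ⟩
    cK' + o + (k + C)        ≡⟨ solve 4 (λ a o c C → a :+ o :+ (c :+ C) := (a :+ C) :+ (o :+ c)) refl cK' o k C ⟩
    (cK' + C) + (o + k)      ≡⟨ cong (_+ (o + k)) comps-rest ⟩
    (aK' + O) + (o + k)      ≡⟨ solve 4 (λ a O o c → (a :+ O) :+ (o :+ c) := (a :+ c) :+ (o :+ O)) refl aK' O o k ⟩
    (aK' + k) + (o + O)      ≡⟨ cong (_+ (o + O)) (sym alive-step) ⟩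
    count (alive K) + (o + O) ∎

-- A minor without edges: every alive vertex is its own component.
invariant-no-edges : ∀ {n m} (S : Sub m) (K : Minor n m) → (∀ f → present K f ≡ false) → RunInvariant S K []
invariant-no-edges {m = m} S K none =
  cong (_+ 0) (trans (comps≡classes (K ∣ S)) (classes-discrete (alive K) (reach (K ∣ S))
    (λ a b h → stays (reach⇒conn (K ∣ S) a b h)))) ,
  trans (count-cong λ f → cong (_∧ (f ∈ₛ S)) (none f)) (count-none m)
  where
  no-adj : ∀ {x y} → Adj (K ∣ S) x y → ⊥
  no-adj (fwd f pr) = false≢true (trans (sym (none f)) (proj₁ (∧-true pr)))
  no-adj (bwd f pr) = false≢true (trans (sym (none f)) (proj₁ (∧-true pr)))
  stays : ∀ {a b} → Conn (K ∣ S) a b → a ≡ b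
  stays base = refl
  stays (step _ ad) = ⊥-elim (no-adj ad)

occ : ∀ {m} → Fin m → List (Fin m) → ℕ
occ f = countL (f ==_)

Lists : ∀ {n m} → Minor n m → List (Fin m) → Set
Lists K p = ∀ f → occ f p ≡ ind (present K f)

lists-cons : ∀ {n m} (K K' : Minor n m) e p → (∀ f → present K' f ≡ present K f ∧ not (f == e)) →
  Lists K (e ∷ p) → present K e ≡ true × Lists K' p
lists-cons K K' e p removed ls = e-present , tail
  where
  head : suc (occ e p) ≡ ind (present K e)
  head = subst (λ z → ind z + occ e p ≡ ind (present K e)) (==-refl e) (ls e)
  e-present : present K e ≡ true
  e-present with present K e | head
  ... | true | _ = refl
  e-once : occ e p ≡ 0
  e-once = ℕP.suc-injective (trans head (cong ind e-present))
  tail : ∀ f → occ f p ≡ ind (present K' f)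
  tail f rewrite removed f with f == e in eq | ls f
  ... | true | _ = subst (λ g → occ g p ≡ ind (present K g ∧ false)) (sym (==-true eq))
                     (trans e-once (cong ind (sym (∧-zeroʳ (present K e)))))
  ... | false | lf = trans lf (cong ind (sym (∧-identityʳ (present K f))))

some-path : ∀ {m h} {P : List (Fin m) → Set} (t : DTree m h) → All P (paths t) → Σ (List (Fin m)) P
some-path (leaf e) (px ∷ []) = (e ∷ []) , px
some-path (node e l r) a with some-path l (AllP.++⁻ˡ (paths l) (AllP.map⁻ a))
... | p , q = (e ∷ p) , q

run-invariant : ∀ {n m h} (S : Sub m) (t : DTree m h) (K : Minor n m) → EndsAlive K →
  All (Lists K) (paths t) → RunInvariant S K (run S K t)
run-invariant S (leaf e) K ea (ls ∷ []) = first-entry (classified S K e)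
  where
  pe = proj₁ (lists-cons K (delete K e) e [] (λ _ → refl) ls)
  open OneStep S K e pe ea
  first-entry : ∀ {t} → Classified S K e t → RunInvariant S K ((e , t) ∷ [])
  first-entry {t} c = invariant-cons S K e t [] (step-effect c) (step-size t)
    (invariant-no-edges S (apply K e t) λ f →
      ind-0 (proj₂ (lists-cons K (apply K e t) e [] (apply-present K e t) ls) f))
    where
    ind-0 : ∀ {b} → 0 ≡ ind b → b ≡ false
    ind-0 {false} _ = refl
run-invariant S (node e l r) K ea ls = first-entry (classified S K e)
  where
  below = AllP.map⁻ ls
  a-path = some-path l (AllP.++⁻ˡ (paths l) below)
  pe = proj₁ (lists-cons K (delete K e) e (proj₁ a-path) (λ _ → refl) (proj₂ a-path))
  open OneStep S K e pe ea
  next : EType → Bool → List (Entry _)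
  next t b = if b then run S (apply K e t) r else run S (apply K e t) l
  child : ∀ t {h'} (s : DTree _ h') → All (λ p → Lists K (e ∷ p)) (paths s) → All (Lists (apply K e t)) (paths s)
  child t s = All.map λ {p} → λ q → proj₂ (lists-cons K (apply K e t) e p (apply-present K e t) q)
  first-entry : ∀ {t} → Classified S K e t → RunInvariant S K ((e , t) ∷ next t (goesRight t))
  first-entry {t} c = invariant-cons S K e t (next t (goesRight t)) (step-effect c) (step-size t) (continue (goesRight t))
    where
    continue : ∀ b → RunInvariant S (apply K e t) (next t b)
    continue true = run-invariant S r (apply K e t) (apply-ends-alive c) (child t r (AllP.++⁻ʳ (paths l) below))
    continue false = run-invariant S l (apply K e t) (apply-ends-alive c) (child t l (AllP.++⁻ˡ (paths l) below))

Consistent : ∀ {m} → Sub m → Entry m → Bool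
Consistent S (e , Si) = e ∈ₛ S
Consistent S (e , Se) = not (e ∈ₛ S)
Consistent S (e , L) = true
Consistent S (e , I) = true

Consistent-all : ∀ {m} → Sub m → List (Entry m) → Set
Consistent-all S = All (λ z → Consistent S z ≡ true)

run-consistent : ∀ {n m h} (S : Sub m) (t : DTree m h) (K : Minor n m) → Consistent-all S (run S K t)
run-consistent S (leaf e) K = entry (classified S K e) ∷ []
  where
  entry : ∀ {t} → Classified S K e t → Consistent S (e , t) ≡ true
  entry (cL _) = refl
  entry (cI _ _) = refl
  entry (cSi _ _ s) = s
  entry (cSe _ _ s) = cong not s
run-consistent S (node e l r) K = entry (classified S K e) ∷ continue (goesRight (classify S K e))
  where
  entry : ∀ {t} → Classified S K e t → Consistent S (e , t) ≡ true
  entry (cL _) = refl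
  entry (cI _ _) = refl
  entry (cSi _ _ s) = s
  entry (cSe _ _ s) = cong not s
  continue : ∀ b → Consistent-all S (if b then run S (apply K e (classify S K e)) r else run S (apply K e (classify S K e)) l)
  continue true = run-consistent S r _
  continue false = run-consistent S l _

classify-agrees : ∀ {n m} (S T : Sub m) (K : Minor n m) e →
  Consistent S (e , classify T K e) ≡ true → classify S K e ≡ classify T K e
classify-agrees S T K e c with isLoop K e
... | true = refl
... | false with isIsthmus K e
...   | true = refl
...   | false with e ∈ₛ T
...     | true = cong (λ b → if b then Si else Se) c
...     | false = cong (λ b → if b then Si else Se) (not-true c)

run-determined : ∀ {n m h} (S T : Sub m) (t : DTree m h) (K : Minor n m) →
  Consistent-all S (run T K t) → run S K t ≡ run T K t
run-determined S T (leaf e) K (c ∷ []) = cong (λ z → (e , z) ∷ []) (classify-agrees S T K e c)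
run-determined S T (node e l r) K (c ∷ cs) rewrite classify-agrees S T K e c =
  cong (_ ∷_) (continue (goesRight (classify T K e)) cs)
  where
  K' = apply K e (classify T K e)
  continue : ∀ b → Consistent-all S (if b then run T K' r else run T K' l) →
    (if b then run S K' r else run S K' l) ≡ (if b then run T K' r else run T K' l)
  continue true = run-determined S T r K'
  continue false = run-determined S T l K'


labels : ∀ {m} {E : Set} → List (Fin m × E) → List (Fin m)
labels = map proj₁

run-path : ∀ {n m h} (S : Sub m) (t : DTree m h) (K : Minor n m) → labels (run S K t) ∈ paths t
run-path S (leaf e) K = here refl
run-path S (node e l r) K = continue (goesRight (classify S K e))
  where
  K' = apply K e (classify S K e)
  continue : ∀ b → (e ∷ labels (if b then run S K' r else run S K' l)) ∈ paths (node e l r)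
  continue true = ∈-map⁺ (e ∷_) (∈-++⁺ʳ (paths l) (run-path S r K'))
  continue false = ∈-map⁺ (e ∷_) (∈-++⁺ˡ (run-path S l K'))

countL-↭ : ∀ {A : Set} (P : A → Bool) {xs ys} → xs ↭ ys → countL P xs ≡ countL P ys
countL-↭ P Perm.refl = refl
countL-↭ P (Perm.prep x p) = cong (_+_ (ind (P x))) (countL-↭ P p)
countL-↭ P (Perm.swap {xs} x y p) =
  trans (swap₃ (ind (P x)) (ind (P y)) (countL P xs)) (cong (λ z → ind (P y) + (ind (P x) + z)) (countL-↭ P p))
  where
  open +-*-Solver using (solve; _:+_; _:=_)
  swap₃ : ∀ a b c → a + (b + c) ≡ b + (a + c)
  swap₃ = solve 3 (λ a b c → a :+ (b :+ c) := b :+ (a :+ c)) refl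
countL-↭ P (Perm.trans p q) = trans (countL-↭ P p) (countL-↭ P q)

occ-allFin : ∀ k (f : Fin k) → occ f (allFin k) ≡ 1
occ-allFin (suc k) zero = cong suc (zero-absent id)
  where
  zero-absent : ∀ {j} (g : Fin j → Fin k) → occ zero (tabulate (λ i → suc (g i))) ≡ 0
  zero-absent {zero} g = refl
  zero-absent {suc j} g = zero-absent (λ i → g (suc i))
occ-allFin (suc k) (suc f) = trans (shift id) (occ-allFin k f)
  where
  shift : ∀ {j} (g : Fin j → Fin k) → occ (suc f) (tabulate (λ i → suc (g i))) ≡ occ f (tabulate g)
  shift {zero} g = refl
  shift {suc j} g = cong (_+_ (ind (f == g zero))) (shift (λ i → g (suc i)))

occ-∈ : ∀ {m} {e : Fin m} {t : EType} {h} → (e , t) ∈ h → 1 ≤ occ e (labels h)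
occ-∈ {e = e} (here refl) rewrite ==-refl e = s≤s z≤n
occ-∈ {e = e} {h = (f , _) ∷ h} (there p) = ℕP.≤-trans (occ-∈ p) (ℕP.m≤n+m _ (ind (e == f)))

twice : ∀ {a} → suc a ≤ 1 → 1 ≤ a → ⊥
twice (s≤s ()) (s≤s _)

entry-unique : ∀ {m} {e : Fin m} {t t' : EType} {h} → occ e (labels h) ≤ 1 → (e , t) ∈ h → (e , t') ∈ h → t ≡ t'
entry-unique u (here refl) (here refl) = refl
entry-unique {e = e} u (here refl) (there q) rewrite ==-refl e = ⊥-elim (twice u (occ-∈ q))
entry-unique {e = e} u (there p) (here refl) rewrite ==-refl e = ⊥-elim (twice u (occ-∈ p))
entry-unique {e = e} {h = (f , _) ∷ h} u (there p) (there q) =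
  entry-unique (ℕP.≤-trans (ℕP.m≤n+m _ (ind (e == f))) u) p q

-- The history of a spanning tree

loopIn : ∀ {m} → Sub m → Entry m → Bool
loopIn S (e , L) = e ∈ₛ S
loopIn S _ = false

entry-balance : ∀ {m} (S : Sub m) h → Consistent-all S h →
  countL (inS S) h + countL (outerIsthmus S) h ≡ countL contracting h + countL (loopIn S) h
entry-balance S [] [] = refl
entry-balance S ((e , t) ∷ h) (c ∷ cs) =
  trans (interchange (ind (e ∈ₛ S)) (countL (inS S) h) (ind (outerIsthmus S (e , t))) _)
    (trans (cong₂ _+_ (balance t c) (entry-balance S h cs))
      (interchange (ind (contracting (e , t))) (ind (loopIn S (e , t))) _ _))
  where
  balance : ∀ t → Consistent S (e , t) ≡ true →
    ind (e ∈ₛ S) + ind (outerIsthmus S (e , t)) ≡ ind (contracting (e , t)) + ind (loopIn S (e , t))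
  balance Si c rewrite c = refl
  balance Se c rewrite not-true c = refl
  balance L _ = ℕP.+-comm (ind (e ∈ₛ S)) 0
  balance I _ with e ∈ₛ S
  ... | true = refl
  ... | false = refl

countL-strict : ∀ {A : Set} (P P' : A → Bool) h → (∀ z → P' z ≡ true → P z ≡ true) →
  ∀ {z₀} → z₀ ∈ h → P z₀ ≡ true → P' z₀ ≡ false → countL P' h < countL P h
countL-strict P P' (z ∷ h) sub (here refl) pz pz' rewrite pz | pz' = s≤s (mono h)
  where
  mono : ∀ h → countL P' h ≤ countL P h
  mono [] = z≤n
  mono (z ∷ h) with P' z in e1 | P z in e2
  ... | true | true = s≤s (mono h)
  ... | false | true = ℕP.m≤n⇒m≤1+n (mono h)
  ... | false | false = mono h
  ... | true | false = ⊥-elim (false≢true (trans (sym e2) (sub z e1)))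
countL-strict P P' (z ∷ h) sub (there m) pz pz' with P' z in e1 | P z in e2
... | true | true = s≤s (countL-strict P P' h sub m pz pz')
... | false | true = ℕP.m≤n⇒m≤1+n (countL-strict P P' h sub m pz pz')
... | false | false = countL-strict P P' h sub m pz pz'
... | true | false = ⊥-elim (false≢true (trans (sym e2) (sub z e1)))

countL-cong : ∀ {A : Set} (P P' : A → Bool) h → (∀ {z} → z ∈ h → P z ≡ P' z) → countL P h ≡ countL P' h
countL-cong P P' [] _ = refl
countL-cong P P' (z ∷ h) e = cong₂ _+_ (cong ind (e (here refl))) (countL-cong P P' h (λ m → e (there m)))

countL-zero : ∀ {A : Set} (P : A → Bool) h → (∀ {z} → z ∈ h → P z ≡ false) → countL P h ≡ 0
countL-zero P [] _ = refl
countL-zero P (z ∷ h) e rewrite e (here refl) = countL-zero P h (λ m → e (there m))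

consistent-local : ∀ {m} (S S' : Sub m) f t → lookup S f ≡ lookup S' f → Consistent S (f , t) ≡ Consistent S' (f , t)
consistent-local S S' f Si e = e
consistent-local S S' f Se e = cong not e
consistent-local S S' f L e = refl
consistent-local S S' f I e = refl

outer-local : ∀ {m} (S S' : Sub m) f t → lookup S f ≡ lookup S' f → outerIsthmus S (f , t) ≡ outerIsthmus S' (f , t)
outer-local S S' f I e = cong not e
outer-local S S' f Si e = refl
outer-local S S' f Se e = refl
outer-local S S' f L e = refl

outer-antitone : ∀ {m} (S S' : Sub m) → (∀ f → lookup S f ≡ true → lookup S' f ≡ true) →
  ∀ z → outerIsthmus S' z ≡ true → outerIsthmus S z ≡ true
outer-antitone S S' sub (f , I) o with lookup S f in e
... | false = refl
... | true = ⊥-elim (false≢true (trans (sym (not-true o)) (sub f e)))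

module TreeHistory (G : Graph) (conn : Connected G) (Δ : DTree (m G) (m G ∸ 1)) (isDT : IsDecisionTree G Δ)
  (T : Sub (m G)) (st : SpanningTree G T) where

  h : List (Entry (m G))
  h = history G Δ T

  lists-whole : All (Lists (whole G)) (paths Δ)
  lists-whole = All.map (λ perm f → trans (countL-↭ (f ==_) perm) (occ-allFin (m G) f)) isDT

  each-edge-once : ∀ f → occ f (labels h) ≡ 1
  each-edge-once = All.lookup lists-whole (run-path T Δ (whole G))

  entry-type-unique : ∀ {e t t'} → (e , t) ∈ h → (e , t') ∈ h → t ≡ t'
  entry-type-unique {e} = entry-unique (ℕP.≤-reflexive (each-edge-once e))

  same-history : ∀ S → Consistent-all S h → history G Δ S ≡ h
  same-history S = run-determined S T Δ (whole G)

  consistent-T : Consistent-all T h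
  consistent-T = run-consistent T Δ (whole G)

  invariant : ∀ S → RunInvariant S (whole G) (history G Δ S)
  invariant S = run-invariant S Δ (whole G) (λ _ _ → refl , refl) lists-whole

  X : ℕ
  X = countL contracting h

  components-formula : ∀ S → Consistent-all S h → c G S + X ≡ n G + countL (outerIsthmus S) h
  components-formula S cs =
    subst (λ h' → c G S + countL contracting h' ≡ n G + countL (outerIsthmus S) h') (same-history S cs)
      (trans (proj₁ (invariant S)) (cong (_+ countL (outerIsthmus S) (history G Δ S)) (count-all (n G))))

  size-formula : ∀ S → Consistent-all S h → card S ≡ countL (inS S) h
  size-formula S cs =
    trans (countFin≡count (λ e → e ∈ₛ S))
      (subst (λ h' → count (λ f → f ∈ₛ S) ≡ countL (inS S) h') (same-history S cs) (proj₂ (invariant S)))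

  -- G has a vertex, so every spanning subgraph has a component.
  comps-pos : ∀ S → 1 ≤ c G S
  comps-pos S = subst (1 ≤_) (sym (comps≡classes (subgraph G S)))
    (classes-pos (λ _ → true) (reach (subgraph G S)) (fromℕ< has-vertex) refl)
    where
    has-vertex : 1 ≤ n G
    has-vertex = subst (_≤ n G) (trans (sym (comps≡classes (whole G))) conn) (count-≤ _)

  toggle-consistent : ∀ {e t} → (e , t) ∈ h → t ≡ I ⊎ t ≡ L → ∀ b → Consistent-all (T [ e ]≔ b) h
  toggle-consistent {e} {t} mem free b = All.tabulate entry
    where
    unconstrained : ∀ {S f t'} → t ≡ t' → t ≡ I ⊎ t ≡ L → Consistent S (f , t') ≡ true
    unconstrained refl (inj₁ refl) = refl
    unconstrained refl (inj₂ refl) = refl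
    entry : ∀ {z} → z ∈ h → Consistent (T [ e ]≔ b) z ≡ true
    entry {f , t'} mz with f ≟ e
    ... | yes refl = unconstrained (entry-type-unique mem mz) free
    ... | no f≢e = trans (consistent-local _ T f t' (lookup∘update′ f≢e T b)) (All.lookup consistent-T mz)

  -- An isthmus entry lies in T: otherwise adding it to T would leave the
  -- history unchanged and remove an outer isthmus, i.e. a component of T.
  isthmus-in-T : ∀ {e} → (e , I) ∈ h → e ∈ₛ T ≡ true
  isthmus-in-T {e} mem with e ∈ₛ T in e∉T
  ... | true = refl
  ... | false = ⊥-elim (ℕP.<-irrefl refl (ℕP.≤-trans (s≤s (ℕP.+-monoˡ-≤ X (comps-pos T'))) fewer))
    where
    T' = T [ e ]≔ true
    bigger : ∀ f → lookup T f ≡ true → lookup T' f ≡ true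
    bigger f Tf with f ≟ e
    ... | yes refl = lookup∘update e T true
    ... | no f≢e = trans (lookup∘update′ f≢e T true) Tf
    fewer : suc (c G T' + X) ≤ 1 + X
    fewer = subst₂ _<_ (sym (components-formula T' (toggle-consistent mem (inj₁ refl) true)))
                       (trans (sym (components-formula T consistent-T)) (cong (_+ X) (proj₁ st)))
              (ℕP.+-monoʳ-< (n G) (countL-strict (outerIsthmus T) (outerIsthmus T') h (outer-antitone T T' bigger)
                                     mem (cong not e∉T) (cong not (lookup∘update e T true))))

  -- A loop entry lies outside T: otherwise removing it from T would leave
  -- the history and the number of components unchanged, yet every edge of
  -- the tree T is an isthmus of T.
  loop-out-of-T : ∀ {e} → (e , L) ∈ h → e ∈ₛ T ≡ false
  loop-out-of-T {e} mem with e ∈ₛ T in e∈T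
  ... | false = refl
  ... | true = ⊥-elim (false≢true (trans (cong₂ _<ᵇ_ (sym (proj₁ st)) (sym (trans deletion c-T'))) isthmus))
    where
    T' = T [ e ]≔ false
    same-outer : countL (outerIsthmus T') h ≡ countL (outerIsthmus T) h
    same-outer = countL-cong _ _ h entry
      where
      entry : ∀ {z} → z ∈ h → outerIsthmus T' z ≡ outerIsthmus T z
      entry {f , t'} mz with f ≟ e
      ... | yes refl with entry-type-unique mem mz
      ...   | refl = refl
      entry {f , t'} mz | no f≢e = outer-local T' T f t' (lookup∘update′ f≢e T false)
    c-T' : c G T' ≡ 1
    c-T' = trans (ℕP.+-cancelʳ-≡ X _ _
                   (trans (components-formula T' (toggle-consistent mem (inj₂ refl) false))
                     (trans (cong (_+_ (n G)) same-outer) (sym (components-formula T consistent-T)))))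
             (proj₁ st)
    deletion : comps (delete (subgraph G T) e) ≡ c G T'
    deletion = comps-present-cong (delete (subgraph G T) e) (subgraph G T') removed
      where
      removed : ∀ f → lookup T f ∧ not (f == e) ≡ lookup T' f
      removed f with f ≟ e
      ... | yes refl rewrite lookup∘update f T false = ∧-zeroʳ _
      ... | no f≢e rewrite lookup∘update′ f≢e T false = ∧-identityʳ _
    isthmus : (comps (subgraph G T) <ᵇ comps (delete (subgraph G T) e)) ≡ true
    isthmus = proj₂ (∧-true {present (subgraph G T) e} (proj₂ st e e∈T))

  -- T has no outer isthmus, so n = 1 + X.
  vertices : n G ≡ 1 + X
  vertices = sym (trans (cong (_+ X) (sym (proj₁ st)))
                   (trans (components-formula T consistent-T)
                     (trans (cong (_+_ (n G)) no-outer) (ℕP.+-identityʳ _))))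
    where
    no-outer : countL (outerIsthmus T) h ≡ 0
    no-outer = countL-zero _ h entry
      where
      entry : ∀ {z} → z ∈ h → outerIsthmus T z ≡ false
      entry {e , I} mz rewrite isthmus-in-T mz = refl
      entry {e , Si} mz = refl
      entry {e , Se} mz = refl
      entry {e , L} mz = refl

  module _ (S : Sub (m G)) (cs : Consistent-all S h) where
    outer = countL (outerIsthmus S) h

    comps-formula : c G S ≡ 1 + outer
    comps-formula = ℕP.+-cancelʳ-≡ X _ _ (trans (components-formula S cs)
      (trans (cong (_+ outer) vertices) (cong suc (ℕP.+-comm X outer))))

    β-formula : β G S ≡ countL (loopIn S) h
    β-formula = trans (cong (_∸ n G) size) (ℕP.m+n∸m≡n (n G) _)
      where
      open ≡-Reasoning
      size : c G S + card S ≡ n G + countL (loopIn S) h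
      size = begin
        c G S + card S                              ≡⟨ cong₂ _+_ comps-formula (size-formula S cs) ⟩
        1 + outer + countL (inS S) h                ≡⟨ cong suc (ℕP.+-comm outer _) ⟩
        1 + (countL (inS S) h + outer)              ≡⟨ cong suc (entry-balance S h cs) ⟩
        1 + (X + countL (loopIn S) h)               ≡⟨ cong (_+ countL (loopIn S) h) (sym vertices) ⟩
        n G + countL (loopIn S) h                   ∎

-- Sums of products over all subsets

prodL : ∀ {A : Set} → (A → ℤ) → List A → ℤ
prodL f [] = + 1
prodL f (x ∷ xs) = f x ℤ.* prodL f xs

prodF : ∀ {k} → (Fin k → ℤ) → ℤ
prodF {zero} g = + 1
prodF {suc k} g = g zero ℤ.* prodF (λ i → g (suc i))

sumF : ∀ {A : Set} → (A → ℤ) → List A → ℤ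
sumF f [] = + 0
sumF f (x ∷ xs) = f x ℤ.+ sumF f xs

sumℤ-map : ∀ {A : Set} (f : A → ℤ) xs → sumℤ (map f xs) ≡ sumF f xs
sumℤ-map f [] = refl
sumℤ-map f (x ∷ xs) = cong (ℤ._+_ (f x)) (sumℤ-map f xs)

sumF-++ : ∀ {A : Set} (f : A → ℤ) xs ys → sumF f (xs ++ ys) ≡ sumF f xs ℤ.+ sumF f ys
sumF-++ f [] ys = sym (ℤP.+-identityˡ _)
sumF-++ f (x ∷ xs) ys = trans (cong (ℤ._+_ (f x)) (sumF-++ f xs ys)) (sym (ℤP.+-assoc (f x) _ _))

sumF-map : ∀ {A B : Set} (f : B → ℤ) (g : A → B) xs → sumF f (map g xs) ≡ sumF (λ x → f (g x)) xs
sumF-map f g [] = refl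
sumF-map f g (x ∷ xs) = cong (ℤ._+_ (f (g x))) (sumF-map f g xs)

sumF-scale : ∀ {A : Set} (a : ℤ) (f : A → ℤ) xs → sumF (λ x → a ℤ.* f x) xs ≡ a ℤ.* sumF f xs
sumF-scale a f [] = sym (ℤP.*-zeroʳ a)
sumF-scale a f (x ∷ xs) = trans (cong (ℤ._+_ (a ℤ.* f x)) (sumF-scale a f xs)) (sym (ℤP.*-distribˡ-+ a (f x) _))

sumF-filter : ∀ {A : Set} {P : A → Set} (P? : ∀ x → Dec (P x)) (f : A → ℤ) xs →
  sumF f (filter P? xs) ≡ sumF (λ x → if does (P? x) then f x else + 0) xs
sumF-filter P? f [] = refl
sumF-filter P? f (x ∷ xs) with does (P? x)
... | true = cong (ℤ._+_ (f x)) (sumF-filter P? f xs)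
... | false = trans (sumF-filter P? f xs) (sym (ℤP.+-identityˡ _))

sumF-cong : ∀ {A : Set} {f g : A → ℤ} → (∀ x → f x ≡ g x) → ∀ xs → sumF f xs ≡ sumF g xs
sumF-cong e [] = refl
sumF-cong e (x ∷ xs) = cong₂ ℤ._+_ (e x) (sumF-cong e xs)

prodL-cong : ∀ {A : Set} {f g : A → ℤ} (xs : List A) → All (λ z → f z ≡ g z) xs → prodL f xs ≡ prodL g xs
prodL-cong [] [] = refl
prodL-cong (z ∷ xs) (e ∷ es) = cong₂ ℤ._*_ e (prodL-cong xs es)

prodF-cong : ∀ {k} {f g : Fin k → ℤ} → f ≐ g → prodF f ≡ prodF g
prodF-cong {zero} e = refl
prodF-cong {suc k} e = cong₂ ℤ._*_ (e zero) (prodF-cong (λ i → e (suc i)))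

prodL-* : ∀ {A : Set} (f g : A → ℤ) xs → prodL (λ x → f x ℤ.* g x) xs ≡ prodL f xs ℤ.* prodL g xs
prodL-* f g [] = refl
prodL-* f g (x ∷ xs) = trans (cong (f x ℤ.* g x ℤ.*_) (prodL-* f g xs)) (regroup (f x) (g x) _ _)
  where
  open ℤSolver.+-*-Solver
  regroup : ∀ a b c d → a ℤ.* b ℤ.* (c ℤ.* d) ≡ a ℤ.* c ℤ.* (b ℤ.* d)
  regroup = solve 4 (λ a b c d → a :* b :* (c :* d) := a :* c :* (b :* d)) refl

pow-countL : ∀ {A : Set} (a : ℤ) (P : A → Bool) xs → a ^ℤ countL P xs ≡ prodL (λ x → if P x then a else + 1) xs
pow-countL a P [] = refl
pow-countL a P (x ∷ xs) with P x
... | true = cong (a ℤ.*_) (pow-countL a P xs)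
... | false = trans (pow-countL a P xs) (sym (ℤP.*-identityˡ _))

length-filter : ∀ {A : Set} (P : A → Bool) xs → length (filter (λ p → T? (P p)) xs) ≡ countL P xs
length-filter P [] = refl
length-filter P (x ∷ xs) with P x
... | true = cong suc (length-filter P xs)
... | false = length-filter P xs

prodF-update : ∀ {k} (g g' : Fin k → ℤ) (e : Fin k) → (∀ i → i ≢ e → g i ≡ g' i) →
  prodF g' ℤ.* g e ≡ prodF g ℤ.* g' e
prodF-update {suc k} g g' zero h
  rewrite prodF-cong {f = λ i → g' (suc i)} {g = λ i → g (suc i)} (λ i → sym (h (suc i) (λ ())))
  = swap₃ (g' zero) (prodF (λ i → g (suc i))) (g zero)
  where
  open ℤSolver.+-*-Solver
  swap₃ : ∀ a b c → a ℤ.* b ℤ.* c ≡ c ℤ.* b ℤ.* a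
  swap₃ = solve 3 (λ a b c → a :* b :* c := c :* b :* a) refl
prodF-update {suc k} g g' (suc e) h rewrite h zero (λ ()) =
  trans (ℤP.*-assoc (g' zero) _ _)
    (trans (cong (g' zero ℤ.*_) (prodF-update (λ i → g (suc i)) (λ i → g' (suc i)) e
                                   (λ i ne → h (suc i) (λ q → ne (suc-inj q)))))
      (sym (ℤP.*-assoc (g' zero) _ _)))
  where
  suc-inj : ∀ {j} {x y : Fin j} → Fin.suc x ≡ suc y → x ≡ y
  suc-inj refl = refl

sum-of-products : ∀ {k} (G : Fin k → Bool → ℤ) →
  sumF (λ S → prodF (λ f → G f (lookup S f))) (allSubs k) ≡ prodF (λ f → G f true ℤ.+ G f false)
sum-of-products {zero} G = refl
sum-of-products {suc k} G = begin
    sumF F (map (true ∷_) (allSubs k) ++ map (false ∷_) (allSubs k))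
  ≡⟨ sumF-++ F (map (true ∷_) (allSubs k)) (map (false ∷_) (allSubs k)) ⟩
    sumF F (map (true ∷_) (allSubs k)) ℤ.+ sumF F (map (false ∷_) (allSubs k))
  ≡⟨ cong₂ ℤ._+_ (sumF-map F (true ∷_) (allSubs k)) (sumF-map F (false ∷_) (allSubs k)) ⟩
    sumF (λ S → G zero true ℤ.* rest S) (allSubs k) ℤ.+ sumF (λ S → G zero false ℤ.* rest S) (allSubs k)
  ≡⟨ cong₂ ℤ._+_ (sumF-scale (G zero true) rest (allSubs k)) (sumF-scale (G zero false) rest (allSubs k)) ⟩
    G zero true ℤ.* sumF rest (allSubs k) ℤ.+ G zero false ℤ.* sumF rest (allSubs k)
  ≡⟨ sym (ℤP.*-distribʳ-+ (sumF rest (allSubs k)) (G zero true) (G zero false)) ⟩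
    (G zero true ℤ.+ G zero false) ℤ.* sumF rest (allSubs k)
  ≡⟨ cong ((G zero true ℤ.+ G zero false) ℤ.*_) (sum-of-products (λ i → G (suc i))) ⟩
    prodF (λ f → G f true ℤ.+ G f false) ∎
  where
  open ≡-Reasoning
  F : Sub (suc k) → ℤ
  F S = prodF (λ f → G f (lookup S f))
  rest : Sub k → ℤ
  rest S = prodF (λ f → G (suc f) (lookup S f))

-- The type of the (first) entry for f in a list of entries, d if none.
typeIn : ∀ {k} {E : Set} → E → List (Fin k × E) → Fin k → E
typeIn d [] f = d
typeIn d ((e , t) ∷ h) f = if f == e then t else typeIn d h f

ifOccurs : ℕ → ℤ → ℤ
ifOccurs zero a = + 1
ifOccurs (suc _) a = a

prodL→prodF : ∀ {k} {E : Set} (d : E) (Q : Fin k → E → ℤ) (h : List (Fin k × E)) →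
  (∀ f → occ f (labels h) ≤ 1) →
  prodL (λ z → Q (proj₁ z) (proj₂ z)) h ≡ prodF (λ f → ifOccurs (occ f (labels h)) (Q f (typeIn d h f)))
prodL→prodF {k} d Q [] once = sym (ones k)
  where
  ones : ∀ k → prodF {k} (λ _ → + 1) ≡ + 1
  ones zero = refl
  ones (suc k) = trans (ℤP.*-identityˡ _) (ones k)
prodL→prodF d Q ((e , t) ∷ h) once = begin
    Q e t ℤ.* prodL (λ z → Q (proj₁ z) (proj₂ z)) h ≡⟨ cong (Q e t ℤ.*_) (prodL→prodF d Q h once-tail) ⟩
    Q e t ℤ.* prodF old                             ≡⟨ ℤP.*-comm (Q e t) _ ⟩
    prodF old ℤ.* Q e t                             ≡⟨ cong (ℤ._*_ (prodF old)) (sym new-e) ⟩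
    prodF old ℤ.* new e                             ≡⟨ sym (prodF-update old new e unchanged) ⟩
    prodF new ℤ.* old e                             ≡⟨ cong (prodF new ℤ.*_) old-e ⟩
    prodF new ℤ.* + 1                               ≡⟨ ℤP.*-identityʳ _ ⟩
    prodF new                                       ∎
  where
  open ≡-Reasoning
  old new : Fin _ → ℤ
  old f = ifOccurs (occ f (labels h)) (Q f (typeIn d h f))
  new f = ifOccurs (occ f (labels ((e , t) ∷ h))) (Q f (typeIn d ((e , t) ∷ h) f))
  once-tail : ∀ f → occ f (labels h) ≤ 1
  once-tail f = ℕP.≤-trans (ℕP.m≤n+m (occ f (labels h)) (ind (f == e))) (once f)
  e-absent : occ e (labels h) ≡ 0
  e-absent with occ e (labels h) | once e
  ... | zero | _ = refl
  ... | suc _ | le rewrite ==-refl e = ⊥-elim (twice le (s≤s z≤n))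
  new-e : new e ≡ Q e t
  new-e rewrite ==-refl e = refl
  old-e : old e ≡ + 1
  old-e rewrite e-absent = refl
  unchanged : ∀ i → i ≢ e → old i ≡ new i
  unchanged i ne rewrite ==-≢ ne = refl

module Weights (x y : ℤ) where

  -- Factor contributed by an entry of type t whose edge is in S iff b.
  φ : EType → Bool → ℤ
  φ Si b = if b then + 1 else + 0
  φ Se b = if b then + 0 else + 1
  φ I b = if b then + 1 else x - + 1
  φ L b = if b then y - + 1 else + 1

  weight : ∀ {m} → Sub m → Entry m → ℤ
  weight S (e , t) = φ t (lookup S e)

  inconsistent-vanishes : ∀ {m} (S : Sub m) h → (Consistent-all S h → ⊥) → prodL (weight S) h ≡ + 0
  inconsistent-vanishes S [] inconsistent = ⊥-elim (inconsistent [])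
  inconsistent-vanishes S (z ∷ h) inconsistent with Consistent S z in c
  ... | true = trans (cong (ℤ._*_ (weight S z)) (inconsistent-vanishes S h (λ cs → inconsistent (c ∷ cs))))
                     (ℤP.*-zeroʳ (weight S z))
  ... | false = cong (ℤ._* prodL (weight S) h) (zero-weight z c)
    where
    zero-weight : ∀ z → Consistent S z ≡ false → weight S z ≡ + 0
    zero-weight (e , Si) c rewrite c = refl
    zero-weight (e , Se) c with lookup S e | c
    ... | true | _ = refl

  consistent-weight : ∀ {m} (S : Sub m) z → Consistent S z ≡ true →
    (if outerIsthmus S z then x - + 1 else + 1) ℤ.* (if loopIn S z then y - + 1 else + 1) ≡ weight S z
  consistent-weight S (e , Si) c rewrite c = refl
  consistent-weight S (e , Se) c rewrite not-true c = refl
  consistent-weight S (e , I) c with lookup S e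
  ... | true = refl
  ... | false = ℤP.*-identityʳ _
  consistent-weight S (e , L) c with lookup S e
  ... | true = ℤP.*-identityˡ _
  ... | false = refl

  membership-sum : ∀ {m} (T : Sub m) e t → (t ≡ I → e ∈ₛ T ≡ true) → (t ≡ L → e ∈ₛ T ≡ false) →
    φ t true ℤ.+ φ t false ≡
      (if isActive t ∧ (e ∈ₛ T) then x else + 1) ℤ.* (if isActive t ∧ not (e ∈ₛ T) then y else + 1)
  membership-sum T e Si _ _ = refl
  membership-sum T e Se _ _ = refl
  membership-sum T e I in-T _ rewrite in-T refl =
    solve 1 (λ x → con (+ 1) :+ (x :- con (+ 1)) := x :* con (+ 1)) refl x
    where open ℤSolver.+-*-Solver
  membership-sum T e L _ out-T rewrite out-T refl =
    solve 1 (λ y → (y :- con (+ 1)) :+ con (+ 1) := con (+ 1) :* y) refl y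
    where open ℤSolver.+-*-Solver

module Summation (G : Graph) (conn : Connected G) (Δ : DTree (m G) (m G ∸ 1)) (isDT : IsDecisionTree G Δ)
  (T : Sub (m G)) (st : SpanningTree G T) (x y : ℤ) where
  open TreeHistory G conn Δ isDT T st
  open Weights x y

  summand : Sub (m G) → ℤ
  summand S = ((x - + 1) ^ℤ (c G S ∸ 1)) ℤ.* ((y - + 1) ^ℤ β G S)

  summand-as-product : ∀ S → Consistent-all S h → summand S ≡ prodL (weight S) h
  summand-as-product S cs = begin
    summand S
      ≡⟨ cong₂ (λ a b → ((x - + 1) ^ℤ a) ℤ.* ((y - + 1) ^ℤ b)) (cong (_∸ 1) (comps-formula S cs)) (β-formula S cs) ⟩
    ((x - + 1) ^ℤ countL (outerIsthmus S) h) ℤ.* ((y - + 1) ^ℤ countL (loopIn S) h)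
      ≡⟨ cong₂ ℤ._*_ (pow-countL (x - + 1) (outerIsthmus S) h) (pow-countL (y - + 1) (loopIn S) h) ⟩
    prodL (λ z → if outerIsthmus S z then x - + 1 else + 1) h ℤ.* prodL (λ z → if loopIn S z then y - + 1 else + 1) h
      ≡⟨ sym (prodL-* _ _ h) ⟩
    prodL (λ z → (if outerIsthmus S z then x - + 1 else + 1) ℤ.* (if loopIn S z then y - + 1 else + 1)) h
      ≡⟨ prodL-cong h (All.map (λ {z} → consistent-weight S z) cs) ⟩
    prodL (weight S) h ∎
    where open ≡-Reasoning

  restricted-summand : ∀ S → (if does (history G Δ S ≟H h) then summand S else + 0) ≡ prodL (weight S) h
  restricted-summand S with history G Δ S ≟H h
  ... | yes same = summand-as-product S (subst (Consistent-all S) same (run-consistent S Δ (whole G)))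
  ... | no differ = sym (inconsistent-vanishes S h (λ cs → differ (same-history S cs)))

  over-edges : (Q : Fin (m G) → EType → ℤ) →
    prodL (λ z → Q (proj₁ z) (proj₂ z)) h ≡ prodF (λ f → Q f (typeIn Si h f))
  over-edges Q = trans (prodL→prodF Si Q h (λ f → ℕP.≤-reflexive (each-edge-once f)))
                   (prodF-cong λ f → cong (λ k → ifOccurs k (Q f (typeIn Si h f))) (each-edge-once f))

  weights-sum : sumF (λ S → prodL (weight S) h) (allSubs (m G)) ≡ prodL (λ z → φ (proj₂ z) true ℤ.+ φ (proj₂ z) false) h
  weights-sum = begin
    sumF (λ S → prodL (weight S) h) (allSubs (m G))
      ≡⟨ sumF-cong (λ S → over-edges (λ e t → φ t (lookup S e))) (allSubs (m G)) ⟩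
    sumF (λ S → prodF (λ f → φ (typeIn Si h f) (lookup S f))) (allSubs (m G))
      ≡⟨ sum-of-products (λ f → φ (typeIn Si h f)) ⟩
    prodF (λ f → φ (typeIn Si h f) true ℤ.+ φ (typeIn Si h f) false)
      ≡⟨ sym (over-edges (λ _ t → φ t true ℤ.+ φ t false)) ⟩
    prodL (λ z → φ (proj₂ z) true ℤ.+ φ (proj₂ z) false) h ∎
    where open ≡-Reasoning

  internal external : Entry (m G) → Bool
  internal z = isActive (proj₂ z) ∧ (proj₁ z ∈ₛ T)
  external z = isActive (proj₂ z) ∧ not (proj₁ z ∈ₛ T)

  membership-sums : prodL (λ z → φ (proj₂ z) true ℤ.+ φ (proj₂ z) false) h ≡
    (x ^ℤ internalActive G Δ T) ℤ.* (y ^ℤ externalActive G Δ T)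
  membership-sums = begin
    prodL (λ z → φ (proj₂ z) true ℤ.+ φ (proj₂ z) false) h
      ≡⟨ prodL-cong h (All.tabulate λ {z} mz → membership-sum T (proj₁ z) (proj₂ z)
                         (λ { refl → isthmus-in-T mz }) (λ { refl → loop-out-of-T mz })) ⟩
    prodL (λ z → (if internal z then x else + 1) ℤ.* (if external z then y else + 1)) h
      ≡⟨ prodL-* _ _ h ⟩
    prodL (λ z → if internal z then x else + 1) h ℤ.* prodL (λ z → if external z then y else + 1) h
      ≡⟨ sym (cong₂ ℤ._*_ (pow-countL x internal h) (pow-countL y external h)) ⟩
    (x ^ℤ countL internal h) ℤ.* (y ^ℤ countL external h)
      ≡⟨ sym (cong₂ (λ a b → (x ^ℤ a) ℤ.* (y ^ℤ b)) (length-filter internal h) (length-filter external h)) ⟩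
    (x ^ℤ internalActive G Δ T) ℤ.* (y ^ℤ externalActive G Δ T) ∎
    where open ≡-Reasoning

proposition6p6 : (G : Graph) → Connected G → m G ≥ 1 →
    (Δ : DTree (m G) (m G ∸ 1)) → IsDecisionTree G Δ →
    (T : Sub (m G)) → SpanningTree G T →
    (x y : ℤ) →
    sumℤ (map (λ S → ((x - + 1) ^ℤ (c G S ∸ 1)) Data.Integer.* ((y - + 1) ^ℤ β G S)) (I-T G Δ T))
      ≡ (x ^ℤ internalActive G Δ T) Data.Integer.* (y ^ℤ externalActive G Δ T)
proposition6p6 G conn _ Δ isDT T st x y = begin
  sumℤ (map summand (I-T G Δ T))                            ≡⟨ sumℤ-map summand (I-T G Δ T) ⟩
  sumF summand (I-T G Δ T)                                  ≡⟨ sumF-filter (λ S → history G Δ S ≟H h) summand (allSubs (m G)) ⟩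
  sumF (λ S → if does (history G Δ S ≟H h) then summand S else + 0) (allSubs (m G))
                                                            ≡⟨ sumF-cong restricted-summand (allSubs (m G)) ⟩
  sumF (λ S → prodL (weight S) h) (allSubs (m G))           ≡⟨ weights-sum ⟩
  prodL (λ z → φ (proj₂ z) true ℤ.+ φ (proj₂ z) false) h    ≡⟨ membership-sums ⟩
  (x ^ℤ internalActive G Δ T) ℤ.* (y ^ℤ externalActive G Δ T) ∎
  where
  open ≡-Reasoning
  open Summation G conn Δ isDT T st x y
  open TreeHistory G conn Δ isDT T st using (h)
  open Weights x y using (φ; weight)
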